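{- Let $k\ge 1$ and $n_1,\dots,n_k\ge 3$ be integers, and let $G$ be the graph obtained by gluing cycle graphs $C_{n_1},\dots,C_{n_k}$ in a chain, where each $C_{n_i}$ is glued along a single edge to the previous cycle $C_{n_{i-1}}$ and along a single edge to the next cycle $C_{n_{i+1}}$ (and non-consecutive cycles share no edges). Then $\mathrm{Jac}(G)$ is a cyclic group of order $x_k$, where $x_1=n_1$, $x_2=n_1n_2-1$, and $x_i=n_ix_{i-1}-x_{i-2}$ for $3\le i\le k$.
   Context: $C_n$ denotes the cycle graph with $n$ vertices. Gluing two cycles along a single edge means identifying one edge of one with one edge of the other (including its endpoints). The Jacobian $\mathrm{Jac}(G)$ of a finite connected multigraph $G$ is the degree-zero part of the chip-firing Picard group $\mathrm{Pic}(G)=\mathrm{Div}(G)/\sim$, equivalently the cokernel of a reduced Laplacian (the Laplacian $D_G-A_G$ with one row and the corresponding column deleted). -}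

module Defs where

open import Data.Bool using (Bool; true; false; if_then_else_; _∧_; _∨_)
open import Data.Nat as ℕ using (ℕ; zero; suc; _≡ᵇ_; _∸_)
open import Data.Integer as ℤ using (ℤ; +_; 0ℤ)
open import Data.Integer.Divisibility using (_∣_)
open import Data.Fin using (Fin; toℕ)
open import Data.List using (List; []; _∷_; map; upTo; drop; _++_; filter; length)
open import Data.Vec using (Vec; toList; zip)
open import Data.Maybe using (Maybe; just; nothing)
open import Data.Product using (Σ; _×_; _,_; proj₁; proj₂)
open import Relation.Binary.PropositionalEquality using (_≡_)

-- Multigraphs: a vertex count N (vertices 0,…,N-1) and a list of edges
-- (unordered; each pair (p , q) is one edge between p and q).

Edge : Set
Edge = ℕ × ℕ

Graph : Set
Graph = ℕ × List Edge

-- Cycle C_n has local vertices 0,…,n-1 and local edges j — (j+1 mod n).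
-- For every cycle after the first, its local edge 0—1 is the edge it is
-- glued along to the previous cycle.  A cycle with parameters (n , d , f)
-- is glued to the NEXT cycle along its local edge d — (d+1 mod n);
-- f decides the orientation of the identification.  (For cycles after
-- the first, d ≠ 0, so the two glued edges are distinct.)

succMod : ℕ → ℕ → ℕ
succMod n j = if suc j ≡ᵇ n then 0 else suc j

embed : Maybe (ℕ × ℕ) → ℕ → ℕ → ℕ
embed nothing N j = N ℕ.+ j
embed (just (a , b)) N zero = a
embed (just (a , b)) N (suc zero) = b
embed (just (a , b)) N (suc (suc j)) = N ℕ.+ j

freshCount : Maybe (ℕ × ℕ) → ℕ → ℕ
freshCount nothing n = n
freshCount (just _) n = n ∸ 2

-- edges of the new cycle that are not already present
-- (when glued, local edge 0—1 is identified with an existing edge)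
newEdges : Maybe (ℕ × ℕ) → ℕ → ℕ → List Edge
newEdges att N n = dropGlued att (map (λ j → embed att N j , embed att N (succMod n j)) (upTo n))
  where
  dropGlued : Maybe (ℕ × ℕ) → List Edge → List Edge
  dropGlued nothing es = es
  dropGlued (just _) es = drop 1 es

build : ℕ → Maybe (ℕ × ℕ) → List (ℕ × ℕ × Bool) → Graph
build N att [] = N , []
build N att ((n , d , f) ∷ cs) =
  let ρ   = embed att N
      N'  = N ℕ.+ freshCount att n
      nxt = if f then (ρ (succMod n d) , ρ d) else (ρ d , ρ (succMod n d))
      rest = build N' (just nxt) cs
  in proj₁ rest , newEdges att N n ++ proj₂ rest

chainGraph : ∀ {k} → Vec ℕ k → Vec ℕ k → Vec Bool k → Graph
chainGraph ns ds fs = build 0 nothing (toList (zip ns (zip ds fs)))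

count : (Edge → Bool) → List Edge → ℕ
count P es = length (filter (λ e → Data.Bool.T? (P e)) es)
  where import Data.Bool

degree : List Edge → ℕ → ℕ
degree es u = count (λ e → proj₁ e ≡ᵇ u) es ℕ.+ count (λ e → proj₂ e ≡ᵇ u) es

adjacency : List Edge → ℕ → ℕ → ℕ
adjacency es u v =
  count (λ e → ((proj₁ e ≡ᵇ u) ∧ (proj₂ e ≡ᵇ v)) ∨ ((proj₁ e ≡ᵇ v) ∧ (proj₂ e ≡ᵇ u))) es

laplacian : List Edge → ℕ → ℕ → ℤ
laplacian es u v = (if u ≡ᵇ v then + degree es u else 0ℤ) ℤ.- + adjacency es u v

redDim : Graph → ℕ
redDim (N , _) = N ∸ 1

reducedLaplacian : (G : Graph) → Fin (redDim G) → Fin (redDim G) → ℤ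
reducedLaplacian (N , es) i j = laplacian es (suc (toℕ i)) (suc (toℕ j))

∑ : (m : ℕ) → (Fin m → ℤ) → ℤ
∑ zero f = 0ℤ
∑ (suc m) f = f Fin.zero ℤ.+ ∑ m (λ i → f (Fin.suc i))
  where import Data.Fin as Fin

applyMat : ∀ {m} → (Fin m → Fin m → ℤ) → (Fin m → ℤ) → Fin m → ℤ
applyMat {m} A z i = ∑ m (λ j → A i j ℤ.* z j)

CokEq : ∀ {m} → (Fin m → Fin m → ℤ) → (Fin m → ℤ) → (Fin m → ℤ) → Set
CokEq {m} A v w = Σ (Fin m → ℤ) λ z → ∀ i → v i ℤ.- w i ≡ applyMat A z i

CokerCyclicOfOrder : ∀ {m} → (Fin m → Fin m → ℤ) → ℤ → Set
CokerCyclicOfOrder {m} A x =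
  Σ (Fin m → ℤ) λ g →
    (∀ (v : Fin m → ℤ) → Σ ℤ λ c → CokEq A v (λ i → c ℤ.* g i))
    × (∀ (c : ℤ) → (CokEq A (λ i → c ℤ.* g i) (λ _ → 0ℤ) → x ∣ c)
                 × (x ∣ c → CokEq A (λ i → c ℤ.* g i) (λ _ → 0ℤ)))

-- Jac(G) ≅ coker of the reduced Laplacian is cyclic of order x
JacCyclicOfOrder : Graph → ℤ → Set
JacCyclicOfOrder G x = CokerCyclicOfOrder (reducedLaplacian G) x

xGo : ℤ → ℤ → List ℕ → ℤ
xGo a b [] = b
xGo a b (n ∷ ns) = xGo b (+ n ℤ.* b ℤ.- a) ns

xSeq : List ℕ → ℤ
xSeq [] = 0ℤ   -- unused (k ≥ 1)
xSeq (n₁ ∷ []) = + n₁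
xSeq (n₁ ∷ n₂ ∷ ns) = xGo (+ n₁) (+ n₁ ℤ.* + n₂ ℤ.- + 1) ns

-- Jac(G) is the cokernel of the reduced Laplacian with sink 0.  We build an integer
-- potential c with c(0) = 0 and c(y₀) = 1 for a neighbour y₀ of 0 which is harmonic
-- except at the two ends of the last gluing edge, where its Laplacian is ±x_k: on each
-- cycle c is linear along the path avoiding the gluing edge, with one kink at the exit
-- edge, and the slopes on successive cycles obey x_i = n_i x_{i-1} - x_{i-2}.  As the
-- Laplacian is self-adjoint, pairing with c is a homomorphism to ℤ/x_k sending δ_{y₀}
-- to 1, so the order of δ_{y₀} is a multiple of x_k.  Firing harmonic vertices cycle
-- by cycle gives δ_u ∼ c(u) δ_{y₀} for every u, so δ_{y₀} generates; firing an end of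
-- the last gluing edge gives x_k δ_{y₀} ∼ 0.

module Submission where

open import Defs
open import Data.Bool using (Bool; true; false; if_then_else_; _∧_; _∨_)
import Data.Bool.Properties as Boolₚ
open import Data.Empty using (⊥-elim)
open import Data.Fin as Fin using (Fin; toℕ; fromℕ<)
import Data.Fin.Properties as Finₚ
open import Data.Integer as ℤ using (ℤ; +_; 0ℤ; 1ℤ; -1ℤ; _+_; _*_; _-_; -_)
import Data.Integer.Properties as ℤₚ
import Data.Integer.Divisibility as ℤ∣ᵤ
open import Data.Integer.Divisibility.Signed as ℤ∣ using (divides)
open import Data.Integer.Tactic.RingSolver using (solve-∀)
open import Data.List using (List; []; _∷_; _++_; map; applyUpTo)
open import Data.List.Relation.Unary.All as All using (All; []; _∷_)
import Data.List.Properties as Listₚ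
import Data.List.Relation.Unary.All.Properties as Allₚ
open import Data.Maybe using (just; nothing)
open import Data.Nat as ℕ using (ℕ; zero; suc; _≡ᵇ_; _<ᵇ_; _≤ᵇ_; _<_; _≤_; z≤n; s≤s; _∸_)
import Data.Nat.Properties as ℕₚ
open import Data.Product using (Σ; _×_; _,_; proj₁; proj₂)
open import Data.Sum using (_⊎_; inj₁; inj₂)
open import Data.Vec using (Vec; []; _∷_; lookup; toList; zip)
import Data.Vec.Properties as Vecₚ
open import Relation.Binary.PropositionalEquality
open import Relation.Nullary using (yes; no)
open import Relation.Nullary.Decidable using (dec-true; dec-false)
open import Relation.Binary.Definitions using (tri<; tri≈; tri>)
open import Algebra.Properties.CommutativeSemigroup ℤₚ.+-commutativeSemigroup
  using () renaming (interchange to +-interchange)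

≡ᵇ-refl : ∀ n → (n ≡ᵇ n) ≡ true
≡ᵇ-refl n = dec-true (n ℕₚ.≟ n) refl

≢⇒≡ᵇ-false : ∀ {m n} → m ≢ n → (m ≡ᵇ n) ≡ false
≢⇒≡ᵇ-false {m} {n} = dec-false (m ℕₚ.≟ n)

≡ᵇ-sym : ∀ m n → (m ≡ᵇ n) ≡ (n ≡ᵇ m)
≡ᵇ-sym m n with m ℕₚ.≟ n
... | yes refl = refl
... | no m≢n rewrite ≢⇒≡ᵇ-false m≢n | ≢⇒≡ᵇ-false (≢-sym m≢n) = refl

<⇒<ᵇ-true : ∀ {m n} → m < n → (m <ᵇ n) ≡ true
<⇒<ᵇ-true {m} {n} = dec-true (m ℕₚ.<? n)

≤⇒<ᵇ-false : ∀ {m n} → n ≤ m → (m <ᵇ n) ≡ false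
≤⇒<ᵇ-false {m} {n} n≤m = dec-false (m ℕₚ.<? n) (ℕₚ.≤⇒≯ n≤m)

∑< : ℕ → (ℕ → ℤ) → ℤ
∑< zero    f = 0ℤ
∑< (suc n) f = ∑< n f + f n

∑<-cong : ∀ n {f g : ℕ → ℤ} → (∀ i → i < n → f i ≡ g i) → ∑< n f ≡ ∑< n g
∑<-cong zero    f≗g = refl
∑<-cong (suc n) f≗g = cong₂ _+_ (∑<-cong n (λ i i<n → f≗g i (ℕₚ.m<n⇒m<1+n i<n))) (f≗g n ℕₚ.≤-refl)

∑<-+ : ∀ n (f g : ℕ → ℤ) → ∑< n (λ i → f i + g i) ≡ ∑< n f + ∑< n g
∑<-+ zero    f g = refl
∑<-+ (suc n) f g rewrite ∑<-+ n f g = +-interchange (∑< n f) (∑< n g) (f n) (g n)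

∑<-*ˡ : ∀ n k (f : ℕ → ℤ) → ∑< n (λ i → k * f i) ≡ k * ∑< n f
∑<-*ˡ zero    k f = sym (ℤₚ.*-zeroʳ k)
∑<-*ˡ (suc n) k f rewrite ∑<-*ˡ n k f = sym (ℤₚ.*-distribˡ-+ k (∑< n f) (f n))

∑<-linear : ∀ n a b (f g : ℕ → ℤ) → ∑< n (λ i → a * f i + b * g i) ≡ a * ∑< n f + b * ∑< n g
∑<-linear n a b f g = trans (∑<-+ n _ _) (cong₂ _+_ (∑<-*ˡ n a f) (∑<-*ˡ n b g))

∑<-zero : ∀ n → ∑< n (λ _ → 0ℤ) ≡ 0ℤ
∑<-zero zero    = refl
∑<-zero (suc n) rewrite ∑<-zero n = refl

∑<-suc : ∀ n (f : ℕ → ℤ) → ∑< (suc n) f ≡ f 0 + ∑< n (λ i → f (suc i))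
∑<-suc zero    f = ℤₚ.+-comm 0ℤ (f 0)
∑<-suc (suc n) f rewrite ∑<-suc n f = ℤₚ.+-assoc (f 0) _ _

∑<-∣ : ∀ n x (f : ℕ → ℤ) → (∀ i → i < n → x ℤ∣.∣ f i) → x ℤ∣.∣ ∑< n f
∑<-∣ zero    x f x∣f = divides 0ℤ refl
∑<-∣ (suc n) x f x∣f =
  ℤ∣.∣m∣n⇒∣m+n (∑<-∣ n x f (λ i i<n → x∣f i (ℕₚ.m<n⇒m<1+n i<n))) (x∣f n ℕₚ.≤-refl)

∑-toℕ : ∀ m (f : ℕ → ℤ) → ∑ m (λ j → f (toℕ j)) ≡ ∑< m f
∑-toℕ zero    f = refl
∑-toℕ (suc m) f = trans (cong (λ t → f 0 + t) (∑-toℕ m (λ n → f (suc n)))) (sym (∑<-suc m f))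

δ : ℕ → ℕ → ℤ
δ y x = if y ≡ᵇ x then 1ℤ else 0ℤ

δ-diag : ∀ y → δ y y ≡ 1ℤ
δ-diag y rewrite ≡ᵇ-refl y = refl

δ-off : ∀ {y x} → y ≢ x → δ y x ≡ 0ℤ
δ-off y≢x rewrite ≢⇒≡ᵇ-false y≢x = refl

δ-sym : ∀ y x → δ y x ≡ δ x y
δ-sym y x = cong (if_then 1ℤ else 0ℤ) (≡ᵇ-sym y x)

∑<-δ-out : ∀ n y (f : ℕ → ℤ) → n ≤ y → ∑< n (λ u → δ y u * f u) ≡ 0ℤ
∑<-δ-out zero    y f _   = refl
∑<-δ-out (suc n) y f n<y rewrite ∑<-δ-out n y f (ℕₚ.<⇒≤ n<y) | δ-off (ℕₚ.>⇒≢ n<y) = refl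

∑<-δ : ∀ n y (f : ℕ → ℤ) → y < n → ∑< n (λ u → δ y u * f u) ≡ f y
∑<-δ (suc n) y f y<1+n with y ℕₚ.≟ n
... | yes refl rewrite δ-diag y | ∑<-δ-out y y f ℕₚ.≤-refl = trans (ℤₚ.+-identityˡ _) (ℤₚ.*-identityˡ (f y))
... | no  y≢n  rewrite δ-off y≢n | ∑<-δ n y f (ℕₚ.≤∧≢⇒< (ℕₚ.≤-pred y<1+n) y≢n) = ℤₚ.+-identityʳ (f y)

∑<-δʳ : ∀ n y (f : ℕ → ℤ) → y < n → ∑< n (λ u → f u * δ y u) ≡ f y
∑<-δʳ n y f y<n = trans (∑<-cong n (λ i _ → ℤₚ.*-comm (f i) (δ y i))) (∑<-δ n y f y<n)

-- The Laplacian as a sum over edges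

edgeLap : Edge → (ℕ → ℤ) → ℕ → ℤ
edgeLap (p , q) z u = δ p u * (z p - z q) + δ q u * (z q - z p)

lap : List Edge → (ℕ → ℤ) → ℕ → ℤ
lap []       z u = 0ℤ
lap (e ∷ es) z u = edgeLap e z u + lap es z u

EdgesIn : (ℕ → Set) → List Edge → Set
EdgesIn P = All (λ e → P (proj₁ e) × P (proj₂ e))

NoLoop : List Edge → Set
NoLoop = All (λ e → proj₁ e ≢ proj₂ e)

edgeLap-δ : ∀ p q (z : ℕ → ℤ) u → edgeLap (p , q) z u ≡ (z q - z p) * (δ q u - δ p u)
edgeLap-δ p q z u = ring (δ p u) (δ q u) (z p) (z q)
  where
  ring : ∀ dp dq zp zq → dp * (zp - zq) + dq * (zq - zp) ≡ (zq - zp) * (dq - dp)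
  ring = solve-∀

lap-++ : ∀ es fs z u → lap (es ++ fs) z u ≡ lap es z u + lap fs z u
lap-++ []       fs z u = sym (ℤₚ.+-identityˡ _)
lap-++ (e ∷ es) fs z u rewrite lap-++ es fs z u = sym (ℤₚ.+-assoc (edgeLap e z u) _ _)

lap-linear : ∀ es a b (z w : ℕ → ℤ) u →
  lap es (λ x → a * z x + b * w x) u ≡ a * lap es z u + b * lap es w u
lap-linear []             a b z w u = sym (cong₂ _+_ (ℤₚ.*-zeroʳ a) (ℤₚ.*-zeroʳ b))
lap-linear ((p , q) ∷ es) a b z w u rewrite lap-linear es a b z w u =
  ring a b (δ p u) (δ q u) (z p) (z q) (w p) (w q) (lap es z u) (lap es w u)
  where
  ring : ∀ a b dp dq zp zq wp wq s t →
    dp * (a * zp + b * wp - (a * zq + b * wq)) + dq * (a * zq + b * wq - (a * zp + b * wp)) + (a * s + b * t)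
    ≡ a * (dp * (zp - zq) + dq * (zq - zp) + s) + b * (dp * (wp - wq) + dq * (wq - wp) + t)
  ring = solve-∀

lap-flat : ∀ es (z : ℕ → ℤ) u → All (λ e → z (proj₁ e) ≡ z (proj₂ e)) es → lap es z u ≡ 0ℤ
lap-flat []             z u []             = refl
lap-flat ((p , q) ∷ es) z u (zp≡zq ∷ flat) rewrite zp≡zq | lap-flat es z u flat | ℤₚ.+-inverseʳ (z q)
  | ℤₚ.*-zeroʳ (δ p u) | ℤₚ.*-zeroʳ (δ q u) = refl

lap-const : ∀ es k u → lap es (λ _ → k) u ≡ 0ℤ
lap-const es k u = lap-flat es (λ _ → k) u (All.universal (λ _ → refl) es)

lap-vanishing : ∀ es (z : ℕ → ℤ) u → EdgesIn (λ v → z v ≡ 0ℤ) es → lap es z u ≡ 0ℤ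
lap-vanishing es z u zero-ends = lap-flat es z u (All.map (λ (zp , zq) → trans zp (sym zq)) zero-ends)

lap-away : ∀ es (z : ℕ → ℤ) u → EdgesIn (_≢ u) es → lap es z u ≡ 0ℤ
lap-away []             z u []                   = refl
lap-away ((p , q) ∷ es) z u ((p≢u , q≢u) ∷ away)
  rewrite δ-off p≢u | δ-off q≢u | lap-away es z u away = refl

dot : ℕ → (ℕ → ℤ) → (ℕ → ℤ) → ℤ
dot N c v = ∑< N (λ u → c u * v u)

dot-+ : ∀ N c (v w : ℕ → ℤ) → dot N c (λ u → v u + w u) ≡ dot N c v + dot N c w
dot-+ N c v w = trans (∑<-cong N (λ u _ → ℤₚ.*-distribˡ-+ (c u) (v u) (w u))) (∑<-+ N _ _)

dot-edgeLap : ∀ N p q (c z : ℕ → ℤ) → p < N → q < N →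
  dot N c (edgeLap (p , q) z) ≡ c p * (z p - z q) + c q * (z q - z p)
dot-edgeLap N p q c z p<N q<N = begin
  ∑< N (λ u → c u * edgeLap (p , q) z u)
    ≡⟨ ∑<-cong N (λ u _ → ring (c u) (δ p u) (δ q u) (z p - z q) (z q - z p)) ⟩
  ∑< N (λ u → (z p - z q) * (δ p u * c u) + (z q - z p) * (δ q u * c u))
    ≡⟨ ∑<-linear N (z p - z q) (z q - z p) _ _ ⟩
  (z p - z q) * ∑< N (λ u → δ p u * c u) + (z q - z p) * ∑< N (λ u → δ q u * c u)
    ≡⟨ cong₂ (λ s t → (z p - z q) * s + (z q - z p) * t) (∑<-δ N p c p<N) (∑<-δ N q c q<N) ⟩
  (z p - z q) * c p + (z q - z p) * c q
    ≡⟨ cong₂ _+_ (ℤₚ.*-comm (z p - z q) (c p)) (ℤₚ.*-comm (z q - z p) (c q)) ⟩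
  c p * (z p - z q) + c q * (z q - z p) ∎
  where
  open ≡-Reasoning
  ring : ∀ c dp dq A B → c * (dp * A + dq * B) ≡ A * (dp * c) + B * (dq * c)
  ring = solve-∀

lap-selfAdjoint : ∀ N es (c z : ℕ → ℤ) → EdgesIn (_< N) es → dot N c (lap es z) ≡ dot N z (lap es c)
lap-selfAdjoint N [] c z [] =
  trans (∑<-cong N (λ u _ → ℤₚ.*-zeroʳ (c u))) (sym (∑<-cong N (λ u _ → ℤₚ.*-zeroʳ (z u))))
lap-selfAdjoint N ((p , q) ∷ es) c z ((p<N , q<N) ∷ es<N) = begin
  dot N c (λ u → edgeLap (p , q) z u + lap es z u)
    ≡⟨ dot-+ N c _ _ ⟩
  dot N c (edgeLap (p , q) z) + dot N c (lap es z)
    ≡⟨ cong₂ _+_ edge (lap-selfAdjoint N es c z es<N) ⟩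
  dot N z (edgeLap (p , q) c) + dot N z (lap es c)
    ≡⟨ dot-+ N z _ _ ⟨
  dot N z (λ u → edgeLap (p , q) c u + lap es c u) ∎
  where
  open ≡-Reasoning
  ring : ∀ cp cq zp zq → cp * (zp - zq) + cq * (zq - zp) ≡ zp * (cp - cq) + zq * (cq - cp)
  ring = solve-∀
  edge : dot N c (edgeLap (p , q) z) ≡ dot N z (edgeLap (p , q) c)
  edge = trans (dot-edgeLap N p q c z p<N q<N)
    (trans (ring (c p) (c q) (z p) (z q)) (sym (dot-edgeLap N p q z c p<N q<N)))

indicator : Bool → ℕ
indicator true  = 1
indicator false = 0

count-∷ : ∀ (P : Edge → Bool) e es → count P (e ∷ es) ≡ indicator (P e) ℕ.+ count P es
count-∷ P e es with P e
... | true  = refl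
... | false = refl

edgeLaplacian : Edge → ℕ → ℕ → ℤ
edgeLaplacian (p , q) u v =
  (if u ≡ᵇ v then + (indicator (p ≡ᵇ u) ℕ.+ indicator (q ≡ᵇ u)) else 0ℤ)
  - + indicator (((p ≡ᵇ u) ∧ (q ≡ᵇ v)) ∨ ((p ≡ᵇ v) ∧ (q ≡ᵇ u)))

laplacian-∷ : ∀ p q es u v → laplacian ((p , q) ∷ es) u v ≡ edgeLaplacian (p , q) u v + laplacian es u v
laplacian-∷ p q es u v
  rewrite count-∷ (λ e → proj₁ e ≡ᵇ u) (p , q) es | count-∷ (λ e → proj₂ e ≡ᵇ u) (p , q) es
        | count-∷ (λ e → ((proj₁ e ≡ᵇ u) ∧ (proj₂ e ≡ᵇ v)) ∨ ((proj₁ e ≡ᵇ v) ∧ (proj₂ e ≡ᵇ u))) (p , q) es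
  = split (u ≡ᵇ v) (indicator (p ≡ᵇ u)) (count (λ e → proj₁ e ≡ᵇ u) es)
                   (indicator (q ≡ᵇ u)) (count (λ e → proj₂ e ≡ᵇ u) es)
                   (indicator (((p ≡ᵇ u) ∧ (q ≡ᵇ v)) ∨ ((p ≡ᵇ v) ∧ (q ≡ᵇ u))))
                   (count (λ e → ((proj₁ e ≡ᵇ u) ∧ (proj₂ e ≡ᵇ v)) ∨ ((proj₁ e ≡ᵇ v) ∧ (proj₂ e ≡ᵇ u))) es)
  where
  split : ∀ (t : Bool) a A b B c C →
    (if t then + ((a ℕ.+ A) ℕ.+ (b ℕ.+ B)) else 0ℤ) - + (c ℕ.+ C)
    ≡ ((if t then + (a ℕ.+ b) else 0ℤ) - + c) + ((if t then + (A ℕ.+ B) else 0ℤ) - + C)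
  split true a A b B c C rewrite ℤₚ.pos-+ (a ℕ.+ A) (b ℕ.+ B) | ℤₚ.pos-+ a A | ℤₚ.pos-+ b B
    | ℤₚ.pos-+ c C | ℤₚ.pos-+ a b | ℤₚ.pos-+ A B = ring (+ a) (+ A) (+ b) (+ B) (+ c) (+ C)
    where
    ring : ∀ a A b B c C → a + A + (b + B) - (c + C) ≡ a + b - c + (A + B - C)
    ring = solve-∀
  split false a A b B c C rewrite ℤₚ.pos-+ c C = ring (+ c) (+ C)
    where
    ring : ∀ c C → 0ℤ - (c + C) ≡ 0ℤ - c + (0ℤ - C)
    ring = solve-∀

edgeLaplacian-δ : ∀ {p q} → p ≢ q → ∀ u v →
  edgeLaplacian (p , q) u v ≡ δ p u * (δ p v - δ q v) + δ q u * (δ q v - δ p v)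
edgeLaplacian-δ {p} {q} p≢q u v with p ℕₚ.≟ u | q ℕₚ.≟ u
... | yes refl | yes refl = ⊥-elim (p≢q refl)
... | yes refl | no q≢p rewrite ≡ᵇ-refl p | ≢⇒≡ᵇ-false q≢p | Boolₚ.∧-zeroʳ (p ≡ᵇ v)
                              | Boolₚ.∨-identityʳ (q ≡ᵇ v) with p ≡ᵇ v | q ≡ᵇ v
...   | true  | true  = refl
...   | true  | false = refl
...   | false | true  = refl
...   | false | false = refl
edgeLaplacian-δ {p} {q} p≢q u v | no p≢q′ | yes refl rewrite ≡ᵇ-refl q | ≢⇒≡ᵇ-false p≢q′
                              | Boolₚ.∧-identityʳ (p ≡ᵇ v) with p ≡ᵇ v | q ≡ᵇ v
...   | true  | true  = refl
...   | true  | false = refl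
...   | false | true  = refl
...   | false | false = refl
edgeLaplacian-δ {p} {q} p≢q u v | no p≢u | no q≢u rewrite ≢⇒≡ᵇ-false p≢u | ≢⇒≡ᵇ-false q≢u
                              | Boolₚ.∧-zeroʳ (p ≡ᵇ v) with u ≡ᵇ v
...   | true  = refl
...   | false = refl

∑<-edgeLaplacian : ∀ N p q (z : ℕ → ℤ) u → p < N → q < N → p ≢ q →
  ∑< N (λ v → edgeLaplacian (p , q) u v * z v) ≡ edgeLap (p , q) z u
∑<-edgeLaplacian N p q z u p<N q<N p≢q = begin
  ∑< N (λ v → edgeLaplacian (p , q) u v * z v)
    ≡⟨ ∑<-cong N (λ v _ → trans (cong (_* z v) (edgeLaplacian-δ p≢q u v))
                                 (ring (δ p u) (δ q u) (δ p v) (δ q v) (z v))) ⟩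
  ∑< N (λ v → (δ p u - δ q u) * (δ p v * z v) + (δ q u - δ p u) * (δ q v * z v))
    ≡⟨ ∑<-linear N (δ p u - δ q u) (δ q u - δ p u) _ _ ⟩
  (δ p u - δ q u) * ∑< N (λ v → δ p v * z v) + (δ q u - δ p u) * ∑< N (λ v → δ q v * z v)
    ≡⟨ cong₂ (λ s t → (δ p u - δ q u) * s + (δ q u - δ p u) * t) (∑<-δ N p z p<N) (∑<-δ N q z q<N) ⟩
  (δ p u - δ q u) * z p + (δ q u - δ p u) * z q
    ≡⟨ ring′ (δ p u) (δ q u) (z p) (z q) ⟩
  edgeLap (p , q) z u ∎
  where
  open ≡-Reasoning
  ring : ∀ dpu dqu dpv dqv zv → (dpu * (dpv - dqv) + dqu * (dqv - dpv)) * zv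
         ≡ (dpu - dqu) * (dpv * zv) + (dqu - dpu) * (dqv * zv)
  ring = solve-∀
  ring′ : ∀ dpu dqu zp zq → (dpu - dqu) * zp + (dqu - dpu) * zq ≡ dpu * (zp - zq) + dqu * (zq - zp)
  ring′ = solve-∀

∑<-laplacian : ∀ N es (z : ℕ → ℤ) u → EdgesIn (_< N) es → NoLoop es →
  ∑< N (λ v → laplacian es u v * z v) ≡ lap es z u
∑<-laplacian N [] z u [] [] =
  trans (∑<-cong N (λ v _ → trans (cong (λ l → (l - + 0) * z v) (Boolₚ.if-eta (u ≡ᵇ v))) (ℤₚ.*-zeroˡ (z v))))
        (∑<-zero N)
∑<-laplacian N ((p , q) ∷ es) z u ((p<N , q<N) ∷ es<N) (p≢q ∷ loopless) = begin
  ∑< N (λ v → laplacian ((p , q) ∷ es) u v * z v)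
    ≡⟨ ∑<-cong N (λ v _ → trans (cong (_* z v) (laplacian-∷ p q es u v))
                                 (ℤₚ.*-distribʳ-+ (z v) (edgeLaplacian (p , q) u v) (laplacian es u v))) ⟩
  ∑< N (λ v → edgeLaplacian (p , q) u v * z v + laplacian es u v * z v)
    ≡⟨ ∑<-+ N _ _ ⟩
  ∑< N (λ v → edgeLaplacian (p , q) u v * z v) + ∑< N (λ v → laplacian es u v * z v)
    ≡⟨ cong₂ _+_ (∑<-edgeLaplacian N p q z u p<N q<N p≢q) (∑<-laplacian N es z u es<N loopless) ⟩
  edgeLap (p , q) z u + lap es z u ∎
  where open ≡-Reasoning

-- Rows of the Laplacian sum to zero, so dropping the sink column loses nothing
-- once z is shifted to vanish at the sink.
applyMat-reducedLaplacian : ∀ Nt es (z : ℕ → ℤ) → EdgesIn (_< Nt) es → NoLoop es →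
  ∀ (i : Fin (Nt ∸ 1)) →
  applyMat (reducedLaplacian (Nt , es)) (λ j → z (suc (toℕ j)) - z 0) i ≡ lap es z (suc (toℕ i))
applyMat-reducedLaplacian (suc m) es z es<N loopless i = begin
  ∑ m (λ j → laplacian es u (suc (toℕ j)) * (z (suc (toℕ j)) - z 0))
    ≡⟨ ∑-toℕ m (λ v → row (suc v)) ⟩
  ∑< m (λ v → row (suc v))
    ≡⟨ trans (cong (_+ ∑< m (λ v → row (suc v))) row0) (ℤₚ.+-identityˡ _) ⟨
  row 0 + ∑< m (λ v → row (suc v))
    ≡⟨ ∑<-suc m row ⟨
  ∑< (suc m) row
    ≡⟨ ∑<-cong (suc m) (λ v _ → ring (laplacian es u v) (z v) (z 0)) ⟩
  ∑< (suc m) (λ v → 1ℤ * (laplacian es u v * z v) + (- z 0) * (laplacian es u v * 1ℤ))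
    ≡⟨ ∑<-linear (suc m) 1ℤ (- z 0) _ _ ⟩
  1ℤ * ∑< (suc m) (λ v → laplacian es u v * z v) + (- z 0) * ∑< (suc m) (λ v → laplacian es u v * 1ℤ)
    ≡⟨ cong₂ (λ s t → 1ℤ * s + (- z 0) * t) (∑<-laplacian (suc m) es z u es<N loopless)
             (trans (∑<-laplacian (suc m) es (λ _ → 1ℤ) u es<N loopless) (lap-const es 1ℤ u)) ⟩
  1ℤ * lap es z u + (- z 0) * 0ℤ
    ≡⟨ ring′ (lap es z u) (z 0) ⟩
  lap es z u ∎
  where
  open ≡-Reasoning
  u : ℕ
  u = suc (toℕ i)
  row : ℕ → ℤ
  row v = laplacian es u v * (z v - z 0)
  row0 : row 0 ≡ 0ℤ
  row0 = trans (cong (laplacian es u 0 *_) (ℤₚ.+-inverseʳ (z 0))) (ℤₚ.*-zeroʳ (laplacian es u 0))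
  ring : ∀ l zv z0 → l * (zv - z0) ≡ 1ℤ * (l * zv) + (- z0) * (l * 1ℤ)
  ring = solve-∀
  ring′ : ∀ a z0 → 1ℤ * a + (- z0) * 0ℤ ≡ a
  ring′ = solve-∀

extend : ∀ {m} → (Fin m → ℤ) → ℕ → ℤ
extend v zero = 0ℤ
extend {m} v (suc u) with u ℕₚ.<? m
... | yes u<m = v (fromℕ< u<m)
... | no _    = 0ℤ

extend-suc : ∀ {m} (v : Fin m → ℤ) (i : Fin m) → extend v (suc (toℕ i)) ≡ v i
extend-suc {m} v i with toℕ i ℕₚ.<? m
... | yes i<m = cong v (Finₚ.fromℕ<-toℕ i i<m)
... | no  i≮m = ⊥-elim (i≮m (Finₚ.toℕ<n i))

∑-cong : ∀ m {f g : Fin m → ℤ} → (∀ j → f j ≡ g j) → ∑ m f ≡ ∑ m g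
∑-cong zero    f≗g = refl
∑-cong (suc m) f≗g = cong₂ _+_ (f≗g Fin.zero) (∑-cong m (λ j → f≗g (Fin.suc j)))

CokEq-cong : ∀ {m} (A : Fin m → Fin m → ℤ) {v v′ w w′ : Fin m → ℤ} →
  (∀ i → v i ≡ v′ i) → (∀ i → w i ≡ w′ i) → CokEq A v w → CokEq A v′ w′
CokEq-cong A v≗v′ w≗w′ (z , eq) = z , λ i → trans (cong₂ _-_ (sym (v≗v′ i)) (sym (w≗w′ i))) (eq i)

suc-toℕ< : ∀ N (i : Fin (N ∸ 1)) → suc (toℕ i) < N
suc-toℕ< (suc m) i = s≤s (Finₚ.toℕ<n i)

-- Firing equivalence and a criterion for cyclicity

module Firing (es : List Edge) (Nt : ℕ) where

  -- The cokernel of the reduced Laplacian, on configurations ℕ → ℤ: firing z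
  -- changes a configuration by lap es z, and vertex 0 (the deleted row) is ignored.
  infix 4 _∼_
  record _∼_ (v w : ℕ → ℤ) : Set where
    constructor fire
    field
      shots   : ℕ → ℤ
      balance : ∀ u → 1 ≤ u → u < Nt → v u - w u ≡ lap es shots u

  AgreeOffSink : (ℕ → ℤ) → (ℕ → ℤ) → Set
  AgreeOffSink v w = ∀ u → 1 ≤ u → u < Nt → v u ≡ w u

  ∼-cong : ∀ {v v′ w w′} → AgreeOffSink v v′ → AgreeOffSink w w′ → v ∼ w → v′ ∼ w′
  ∼-cong v≗v′ w≗w′ (fire z eq) = fire z λ u 1≤u u<Nt →
    trans (cong₂ _-_ (sym (v≗v′ u 1≤u u<Nt)) (sym (w≗w′ u 1≤u u<Nt))) (eq u 1≤u u<Nt)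

  ∼-linear : ∀ a b {v₁ w₁ v₂ w₂} → v₁ ∼ w₁ → v₂ ∼ w₂ →
    (λ x → a * v₁ x + b * v₂ x) ∼ (λ x → a * w₁ x + b * w₂ x)
  ∼-linear a b {v₁} {w₁} {v₂} {w₂} (fire z₁ eq₁) (fire z₂ eq₂) = fire (λ x → a * z₁ x + b * z₂ x) λ u 1≤u u<Nt →
    trans (ring a b (v₁ u) (w₁ u) (v₂ u) (w₂ u))
      (trans (cong₂ (λ s t → a * s + b * t) (eq₁ u 1≤u u<Nt) (eq₂ u 1≤u u<Nt))
             (sym (lap-linear es a b z₁ z₂ u)))
    where
    ring : ∀ a b v₁ w₁ v₂ w₂ → a * v₁ + b * v₂ - (a * w₁ + b * w₂) ≡ a * (v₁ - w₁) + b * (v₂ - w₂)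
    ring = solve-∀

  ∼-refl : ∀ v → v ∼ v
  ∼-refl v = fire (λ _ → 0ℤ) λ u _ _ → trans (ℤₚ.+-inverseʳ (v u)) (sym (lap-const es 0ℤ u))

  ∼-sym : ∀ {v w} → v ∼ w → w ∼ v
  ∼-sym {v} {w} (fire z eq) = fire (λ x → -1ℤ * z x + 0ℤ * z x) λ u 1≤u u<Nt →
    trans (ring (v u) (w u))
      (trans (cong (λ t → -1ℤ * t + 0ℤ * t) (eq u 1≤u u<Nt)) (sym (lap-linear es -1ℤ 0ℤ z z u)))
    where
    ring : ∀ v w → w - v ≡ -1ℤ * (v - w) + 0ℤ * (v - w)
    ring = solve-∀

  ∼-trans : ∀ {u v w} → u ∼ v → v ∼ w → u ∼ w
  ∼-trans {u} {v} {w} (fire z₁ eq₁) (fire z₂ eq₂) = fire (λ x → 1ℤ * z₁ x + 1ℤ * z₂ x) λ x 1≤x x<Nt →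
    trans (ring (u x) (v x) (w x))
      (trans (cong₂ (λ s t → 1ℤ * s + 1ℤ * t) (eq₁ x 1≤x x<Nt) (eq₂ x 1≤x x<Nt))
             (sym (lap-linear es 1ℤ 1ℤ z₁ z₂ x)))
    where
    ring : ∀ a b c → a - c ≡ 1ℤ * (a - b) + 1ℤ * (b - c)
    ring = solve-∀

  lap∼0 : ∀ z → lap es z ∼ (λ _ → 0ℤ)
  lap∼0 z = fire z λ u _ _ → ℤₚ.+-identityʳ (lap es z u)

  module Collapse (es<Nt : EdgesIn (_< Nt) es) (c : ℕ → ℤ) (y₀ : ℕ) where

    weight : (ℕ → ℤ) → ℤ
    weight = dot Nt c

    Collapses : (ℕ → ℤ) → Set
    Collapses v = v ∼ (λ x → weight v * δ y₀ x)

    Collapsible : ℕ → Set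
    Collapsible u = Collapses (δ u)

    weight-linear : ∀ a b v w → weight (λ x → a * v x + b * w x) ≡ a * weight v + b * weight w
    weight-linear a b v w =
      trans (∑<-cong Nt (λ i _ → ring a b (c i) (v i) (w i))) (∑<-linear Nt a b _ _)
      where
      ring : ∀ a b c v w → c * (a * v + b * w) ≡ a * (c * v) + b * (c * w)
      ring = solve-∀

    weight-cong : ∀ {v w} → (∀ u → u < Nt → v u ≡ w u) → weight v ≡ weight w
    weight-cong v≗w = ∑<-cong Nt (λ i i<Nt → cong (c i *_) (v≗w i i<Nt))

    weight-δ : ∀ u → u < Nt → weight (δ u) ≡ c u
    weight-δ u = ∑<-δʳ Nt u c

    weight-lap : ∀ y → y < Nt → weight (lap es (δ y)) ≡ lap es c y
    weight-lap y y<Nt = trans (lap-selfAdjoint Nt es c (δ y) es<Nt) (∑<-δ Nt y (lap es c) y<Nt)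

    collapses-cong : ∀ {v w} → (∀ u → u < Nt → v u ≡ w u) → Collapses v → Collapses w
    collapses-cong v≗w =
      ∼-cong (λ u _ u<Nt → v≗w u u<Nt) (λ u _ _ → cong (_* δ y₀ u) (weight-cong v≗w))

    collapses-linear : ∀ a b {v w} → Collapses v → Collapses w → Collapses (λ x → a * v x + b * w x)
    collapses-linear a b {v} {w} cv cw =
      ∼-cong (λ _ _ _ → refl) (λ u _ _ → combine u)
             (∼-linear a b {v} {λ x → weight v * δ y₀ x} {w} {λ x → weight w * δ y₀ x} cv cw)
      where
      ring : ∀ a b s t d → a * (s * d) + b * (t * d) ≡ (a * s + b * t) * d
      ring = solve-∀
      combine : ∀ u → a * (weight v * δ y₀ u) + b * (weight w * δ y₀ u)
                    ≡ weight (λ x → a * v x + b * w x) * δ y₀ u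
      combine u = trans (ring a b (weight v) (weight w) (δ y₀ u))
                        (cong (_* δ y₀ u) (sym (weight-linear a b v w)))

    collapses-scaled : ∀ a {v} → Collapses v → Collapses (λ x → a * v x)
    collapses-scaled a {v} cv =
      collapses-cong (λ x _ → trans (cong (λ t → a * v x + t) (ℤₚ.*-zeroˡ (v x))) (ℤₚ.+-identityʳ _))
                     (collapses-linear a 0ℤ {v} {v} cv cv)

    collapses-zero : Collapses (λ _ → 0ℤ)
    collapses-zero = ∼-cong (λ _ _ _ → refl) (λ u _ _ → cong (_* δ y₀ u) (sym weight-zero)) (∼-refl _)
      where
      weight-zero : weight (λ _ → 0ℤ) ≡ 0ℤ
      weight-zero = trans (∑<-cong Nt (λ i _ → ℤₚ.*-zeroʳ (c i))) (∑<-zero Nt)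

    collapses-∑ : ∀ n (f : ℕ → ℕ → ℤ) → (∀ i → i < n → Collapses (f i)) →
      Collapses (λ x → ∑< n (λ i → f i x))
    collapses-∑ zero    f _  = collapses-zero
    collapses-∑ (suc n) f cf =
      collapses-cong (λ x _ → cong₂ _+_ (ℤₚ.*-identityˡ (∑< n (λ i → f i x))) (ℤₚ.*-identityˡ (f n x)))
        (collapses-linear 1ℤ 1ℤ (collapses-∑ n f (λ i i<n → cf i (ℕₚ.m<n⇒m<1+n i<n))) (cf n ℕₚ.≤-refl))

    collapses-supported : ∀ v → (∀ u → u < Nt → v u ≡ 0ℤ ⊎ Collapsible u) → Collapses v
    collapses-supported v supp = collapses-cong expand (collapses-∑ Nt (λ u x → v u * δ u x) term)
      where
      term : ∀ u → u < Nt → Collapses (λ x → v u * δ u x)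
      term u u<Nt with supp u u<Nt
      ... | inj₁ vu≡0 = collapses-cong (λ x _ → sym (trans (cong (_* δ u x) vu≡0) (ℤₚ.*-zeroˡ (δ u x))))
                                        collapses-zero
      ... | inj₂ cu   = collapses-scaled (v u) cu
      expand : ∀ x → x < Nt → ∑< Nt (λ u → v u * δ u x) ≡ v x
      expand x x<Nt = trans (∑<-cong Nt (λ u _ → trans (ℤₚ.*-comm (v u) (δ u x)) (cong (_* v u) (δ-sym u x))))
                            (∑<-δ Nt x v x<Nt)

    collapsible-sink : 0 < Nt → c 0 ≡ 0ℤ → Collapsible 0
    collapsible-sink 0<Nt c0≡0 =
      ∼-cong (λ u 1≤u _ → sym (δ-off (ℕₚ.<⇒≢ 1≤u)))
             (λ u _ _ → cong (_* δ y₀ u) (sym (trans (weight-δ 0 0<Nt) c0≡0)))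
             (∼-refl (λ _ → 0ℤ))

    collapsible-base : y₀ < Nt → c y₀ ≡ 1ℤ → Collapsible y₀
    collapsible-base y₀<Nt cy₀≡1 =
      ∼-cong (λ _ _ _ → refl)
             (λ u _ _ → sym (trans (cong (_* δ y₀ u) (trans (weight-δ y₀ y₀<Nt) cy₀≡1)) (ℤₚ.*-identityˡ _)))
             (∼-refl (δ y₀))

    -- δ w = (lap (δ y) + δ w) − lap (δ y): the first is supported on collapsible
    -- vertices, the second is a firing of weight lap c y = 0.
    collapsible-by-firing : ∀ y → y < Nt → lap es c y ≡ 0ℤ → ∀ w → w < Nt → lap es (δ y) w ≡ -1ℤ →
      (∀ u → u < Nt → u ≢ w → lap es (δ y) u ≡ 0ℤ ⊎ Collapsible u) → Collapsible w
    collapsible-by-firing y y<Nt harmonic w w<Nt lap-w supp =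
      collapses-cong (λ u _ → ring (fired u) (δ w u))
                     (collapses-linear 1ℤ -1ℤ {λ x → fired x + δ w x} {fired} chips firing)
      where
      fired : ℕ → ℤ
      fired = lap es (δ y)
      firing : Collapses fired
      firing = ∼-cong (λ _ _ _ → refl)
        (λ u _ _ → cong (_* δ y₀ u) (sym (trans (weight-lap y y<Nt) harmonic))) (lap∼0 (δ y))
      chips : Collapses (λ x → fired x + δ w x)
      chips = collapses-supported _ supported
        where
        supported : ∀ u → u < Nt → fired u + δ w u ≡ 0ℤ ⊎ Collapsible u
        supported u u<Nt with u ℕₚ.≟ w
        ... | yes refl = inj₁ (cong₂ _+_ lap-w (δ-diag u))
        ... | no u≢w with supp u u<Nt u≢w
        ...   | inj₁ fired≡0 = inj₁ (cong₂ _+_ fired≡0 (δ-off (≢-sym u≢w)))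
        ...   | inj₂ cu      = inj₂ cu
      ring : ∀ f d → 1ℤ * (f + d) + -1ℤ * f ≡ d
      ring = solve-∀

    order-divides : c 0 ≡ 0ℤ → y₀ < Nt → c y₀ ≡ 1ℤ → ∀ x → (∀ u → u < Nt → x ℤ∣.∣ lap es c u) →
      ∀ k → (λ u → k * δ y₀ u) ∼ (λ _ → 0ℤ) → x ℤ∣.∣ k
    order-divides c0≡0 y₀<Nt cy₀≡1 x x∣lap k (fire z balance) =
      subst (x ℤ∣.∣_) (sym k≡) (∑<-∣ Nt x _ (λ u u<Nt → ℤ∣.∣n⇒∣m*n (z u) (x∣lap u u<Nt)))
      where
      open ≡-Reasoning
      on-vertices : ∀ u → u < Nt → c u * (k * δ y₀ u - 0ℤ) ≡ c u * lap es z u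
      on-vertices zero    _    rewrite c0≡0 = refl
      on-vertices (suc u) u<Nt = cong (c (suc u) *_) (balance (suc u) (s≤s z≤n) u<Nt)
      ring : ∀ d c k → d * (c * k) ≡ c * (k * d - 0ℤ)
      ring = solve-∀
      k≡ : k ≡ dot Nt z (lap es c)
      k≡ = begin
        k                                            ≡⟨ trans (cong (_* k) cy₀≡1) (ℤₚ.*-identityˡ k) ⟨
        c y₀ * k                                     ≡⟨ ∑<-δ Nt y₀ (λ u → c u * k) y₀<Nt ⟨
        ∑< Nt (λ u → δ y₀ u * (c u * k))             ≡⟨ ∑<-cong Nt (λ u _ → ring (δ y₀ u) (c u) k) ⟩
        ∑< Nt (λ u → c u * (k * δ y₀ u - 0ℤ))        ≡⟨ ∑<-cong Nt on-vertices ⟩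
        dot Nt c (lap es z)                          ≡⟨ lap-selfAdjoint Nt es c z es<Nt ⟩
        dot Nt z (lap es c)                          ∎

    kills-multiples : ∀ d → (λ u → d * δ y₀ u) ∼ (λ _ → 0ℤ) →
      ∀ k → d ℤ∣.∣ k → (λ u → k * δ y₀ u) ∼ (λ _ → 0ℤ)
    kills-multiples d d∼0 k (divides q k≡qd) =
      ∼-cong (λ u _ _ → trans (ring q d (δ y₀ u)) (cong (_* δ y₀ u) (sym k≡qd))) (λ _ _ _ → ring₀ q)
             (∼-linear q 0ℤ d∼0 d∼0)
      where
      ring : ∀ q d t → q * (d * t) + 0ℤ * (d * t) ≡ (q * d) * t
      ring = solve-∀
      ring₀ : ∀ q → q * 0ℤ + 0ℤ * 0ℤ ≡ 0ℤ
      ring₀ = solve-∀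

    firing-weight∼0 : (∀ u → u < Nt → Collapsible u) → ∀ y → y < Nt → (λ u → lap es c y * δ y₀ u) ∼ (λ _ → 0ℤ)
    firing-weight∼0 all-collapsible y y<Nt =
      ∼-trans (∼-cong (λ u _ _ → cong (_* δ y₀ u) (weight-lap y y<Nt)) (λ _ _ _ → refl)
                      (∼-sym (collapses-supported (lap es (δ y)) (λ u u<Nt → inj₂ (all-collapsible u u<Nt)))))
              (lap∼0 (δ y))

    order-kills : (∀ u → u < Nt → Collapsible u) → ∀ x y₁ → y₁ < Nt →
      lap es c y₁ ≡ x ⊎ lap es c y₁ ≡ - x → ∀ k → x ℤ∣.∣ k → (λ u → k * δ y₀ u) ∼ (λ _ → 0ℤ)
    order-kills all-collapsible x y₁ y₁<Nt (inj₁ refl) k x∣k =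
      kills-multiples _ (firing-weight∼0 all-collapsible y₁ y₁<Nt) k x∣k
    order-kills all-collapsible x y₁ y₁<Nt (inj₂ eq) k (divides q k≡qx) =
      kills-multiples _ (firing-weight∼0 all-collapsible y₁ y₁<Nt) k
        (divides (- q) (trans k≡qx (trans (ring q x) (cong ((- q) *_) (sym eq)))))
      where
      ring : ∀ q x → q * x ≡ (- q) * (- x)
      ring = solve-∀

  module _ (es<Nt : EdgesIn (_< Nt) es) (loopless : NoLoop es) where

    private
      A : Fin (Nt ∸ 1) → Fin (Nt ∸ 1) → ℤ
      A = reducedLaplacian (Nt , es)

    ∼⇒CokEq : ∀ {v w} → v ∼ w → CokEq A (λ i → v (suc (toℕ i))) (λ i → w (suc (toℕ i)))
    ∼⇒CokEq (fire z balance) = (λ j → z (suc (toℕ j)) - z 0) , λ i →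
      trans (balance _ (s≤s z≤n) (suc-toℕ< Nt i)) (sym (applyMat-reducedLaplacian Nt es z es<Nt loopless i))

    CokEq⇒∼ : ∀ {v w} → CokEq A (λ i → v (suc (toℕ i))) (λ i → w (suc (toℕ i))) → v ∼ w
    CokEq⇒∼ {v} {w} (z , eq) = fire (extend z) balance
      where
      balance-at : ∀ i → v (suc (toℕ i)) - w (suc (toℕ i)) ≡ lap es (extend z) (suc (toℕ i))
      balance-at i = begin
        v (suc (toℕ i)) - w (suc (toℕ i))
          ≡⟨ eq i ⟩
        applyMat A z i
          ≡⟨ ∑-cong (Nt ∸ 1) (λ j → cong (A i j *_) (sym (trans (ℤₚ.+-identityʳ _) (extend-suc z j)))) ⟩
        applyMat A (λ j → extend z (suc (toℕ j)) - extend z 0) i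
          ≡⟨ applyMat-reducedLaplacian Nt es (extend z) es<Nt loopless i ⟩
        lap es (extend z) (suc (toℕ i)) ∎
        where open ≡-Reasoning
      balance : ∀ u → 1 ≤ u → u < Nt → v u - w u ≡ lap es (extend z) u
      balance (suc u) _ u<Nt = subst (λ t → v (suc t) - w (suc t) ≡ lap es (extend z) (suc t))
                                     (Finₚ.toℕ-fromℕ< u<Nt-1) (balance-at (fromℕ< u<Nt-1))
        where
        u<Nt-1 : u < Nt ∸ 1
        u<Nt-1 = ℕₚ.∸-monoˡ-< u<Nt (s≤s z≤n)

jacobian-cyclic : ∀ Nt es (es<Nt : EdgesIn (_< Nt) es) → NoLoop es →
  ∀ c y₀ → c 0 ≡ 0ℤ → y₀ < Nt → c y₀ ≡ 1ℤ →
  (∀ u → u < Nt → Firing.Collapse.Collapsible es Nt es<Nt c y₀ u) →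
  ∀ x → (∀ u → u < Nt → x ℤ∣.∣ lap es c u) →
  ∀ y₁ → y₁ < Nt → lap es c y₁ ≡ x ⊎ lap es c y₁ ≡ - x →
  JacCyclicOfOrder (Nt , es) x
jacobian-cyclic Nt es es<Nt loopless c y₀ c0≡0 y₀<Nt cy₀≡1 all-collapsible x x∣lap y₁ y₁<Nt lap-y₁ =
  generator , generates , order
  where
  open Firing es Nt
  open Collapse es<Nt c y₀
  generator : Fin (Nt ∸ 1) → ℤ
  generator i = δ y₀ (suc (toℕ i))
  generates : ∀ v → Σ ℤ λ k → CokEq (reducedLaplacian (Nt , es)) v (λ i → k * generator i)
  generates v = weight (extend v) , CokEq-cong (reducedLaplacian (Nt , es)) (extend-suc v) (λ _ → refl)
    (∼⇒CokEq es<Nt loopless (collapses-supported (extend v) (λ u u<Nt → inj₂ (all-collapsible u u<Nt))))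
  order : ∀ k → (CokEq (reducedLaplacian (Nt , es)) (λ i → k * generator i) (λ _ → 0ℤ) → x ℤ∣ᵤ.∣ k)
                × (x ℤ∣ᵤ.∣ k → CokEq (reducedLaplacian (Nt , es)) (λ i → k * generator i) (λ _ → 0ℤ))
  order k = (λ k∼0 → ℤ∣.∣⇒∣ᵤ (order-divides c0≡0 y₀<Nt cy₀≡1 x x∣lap k (CokEq⇒∼ es<Nt loopless k∼0)))
          , (λ x∣k → ∼⇒CokEq es<Nt loopless (order-kills all-collapsible x y₁ y₁<Nt lap-y₁ k (ℤ∣.∣ᵤ⇒∣ x∣k)))

pathLap : (ℕ → ℕ) → ℕ → (ℕ → ℤ) → ℕ → ℤ
pathLap P m z w = ∑< m (λ t → edgeLap (P t , P (suc t)) z w)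

InjectiveUpTo : (ℕ → ℕ) → ℕ → Set
InjectiveUpTo P m = ∀ s t → s ≤ m → t ≤ m → P s ≡ P t → s ≡ t

δ-injective : ∀ {P m} → InjectiveUpTo P m → ∀ {s r} → s ≤ m → r ≤ m → δ (P s) (P r) ≡ δ s r
δ-injective {P} inj {s} {r} s≤m r≤m with s ℕₚ.≟ r
... | yes refl = trans (δ-diag (P s)) (sym (δ-diag s))
... | no s≢r   = trans (δ-off (λ Ps≡Pr → s≢r (inj s r s≤m r≤m Ps≡Pr))) (sym (δ-off s≢r))

path-hits? : ∀ (P : ℕ → ℕ) m w → (Σ ℕ λ r → r ≤ m × P r ≡ w) ⊎ (∀ t → t ≤ m → P t ≢ w)
path-hits? P zero w with P 0 ℕₚ.≟ w
... | yes P0≡w = inj₁ (0 , z≤n , P0≡w)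
... | no  P0≢w = inj₂ λ { zero _ → P0≢w }
path-hits? P (suc m) w with path-hits? P m w | P (suc m) ℕₚ.≟ w
... | inj₁ (r , r≤m , Pr≡w) | _       = inj₁ (r , ℕₚ.m≤n⇒m≤1+n r≤m , Pr≡w)
... | inj₂ _                | yes P≡w = inj₁ (suc m , ℕₚ.≤-refl , P≡w)
... | inj₂ misses           | no  P≢w = inj₂ λ t t≤1+m → case t t≤1+m
  where
  case : ∀ t → t ≤ suc m → P t ≢ w
  case t t≤1+m with t ℕₚ.≟ suc m
  ... | yes refl = P≢w
  ... | no t≢1+m = misses t (ℕₚ.≤-pred (ℕₚ.≤∧≢⇒< t≤1+m t≢1+m))

pathLap-off : ∀ P m z w → (∀ t → t ≤ m → P t ≢ w) → pathLap P m z w ≡ 0ℤ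
pathLap-off P m z w misses = trans (∑<-cong m off) (∑<-zero m)
  where
  off : ∀ t → t < m → edgeLap (P t , P (suc t)) z w ≡ 0ℤ
  off t t<m rewrite δ-off (misses t (ℕₚ.<⇒≤ t<m)) | δ-off (misses (suc t) t<m) = refl

data Position : ℕ → ℕ → Set where
  first : ∀ {m} → Position (suc m) 0
  inner : ∀ {m r} → suc r < suc m → Position (suc m) (suc r)
  last  : ∀ {m} → Position (suc m) (suc m)

position : ∀ m r → r ≤ suc m → Position (suc m) r
position m zero    _       = first
position m (suc r) r<1+m with r ℕₚ.≟ m
... | yes refl = last
... | no  r≢m  = inner (s≤s (ℕₚ.≤∧≢⇒< (ℕₚ.≤-pred r<1+m) r≢m))

pathLap-at : ∀ {P m} → InjectiveUpTo P m → ∀ (z : ℕ → ℤ) r → r ≤ m →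
  pathLap P m z (P r) ≡ ∑< m (λ t → δ r t * (z (P t) - z (P (suc t))))
                      + ∑< m (λ t → δ r (suc t) * (z (P (suc t)) - z (P t)))
pathLap-at {P} {m} inj z r r≤m = trans (∑<-cong m edge) (∑<-+ m _ _)
  where
  edge : ∀ t → t < m → edgeLap (P t , P (suc t)) z (P r)
                     ≡ δ r t * (z (P t) - z (P (suc t))) + δ r (suc t) * (z (P (suc t)) - z (P t))
  edge t t<m rewrite δ-injective inj (ℕₚ.<⇒≤ t<m) r≤m | δ-injective inj t<m r≤m
                   | δ-sym t r | δ-sym (suc t) r = refl

pathLap-first : ∀ {P m} → InjectiveUpTo P (suc m) → ∀ (z : ℕ → ℤ) →
  pathLap P (suc m) z (P 0) ≡ z (P 0) - z (P 1)
pathLap-first {P} {m} inj z = trans (pathLap-at inj z 0 z≤n)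
  (trans (cong₂ _+_ (∑<-δ (suc m) 0 (λ t → z (P t) - z (P (suc t))) (s≤s z≤n))
                    (trans (∑<-cong (suc m) (λ t _ → ℤₚ.*-zeroˡ (z (P (suc t)) - z (P t)))) (∑<-zero (suc m))))
         (ℤₚ.+-identityʳ _))

pathLap-inner : ∀ {P m} → InjectiveUpTo P m → ∀ (z : ℕ → ℤ) r → suc r < m →
  pathLap P m z (P (suc r)) ≡ (z (P (suc r)) - z (P (suc (suc r)))) + (z (P (suc r)) - z (P r))
pathLap-inner {P} {m} inj z r 1+r<m = trans (pathLap-at inj z (suc r) (ℕₚ.<⇒≤ 1+r<m))
  (cong₂ _+_ (∑<-δ m (suc r) (λ t → z (P t) - z (P (suc t))) 1+r<m)
             (∑<-δ m r (λ t → z (P (suc t)) - z (P t)) (ℕₚ.<-trans (ℕₚ.n<1+n r) 1+r<m)))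

pathLap-last : ∀ {P m} → InjectiveUpTo P (suc m) → ∀ (z : ℕ → ℤ) →
  pathLap P (suc m) z (P (suc m)) ≡ z (P (suc m)) - z (P m)
pathLap-last {P} {m} inj z = trans (pathLap-at inj z (suc m) ℕₚ.≤-refl)
  (trans (cong₂ _+_ (∑<-δ-out (suc m) (suc m) (λ t → z (P t) - z (P (suc t))) ℕₚ.≤-refl)
                    (∑<-δ (suc m) m (λ t → z (P (suc t)) - z (P t)) ℕₚ.≤-refl))
         (ℤₚ.+-identityˡ _))

pathLap-kinked : ∀ {P m} (c : ℕ → ℤ) E K d → InjectiveUpTo P m → suc d ≤ m →
  (∀ t → t < m → c (P (suc t)) ≡ c (P t) + (E + δ d t * K)) →
  ∀ w → pathLap P m c w + E * (δ (P 0) w - δ (P m) w) ≡ K * (δ (P (suc d)) w - δ (P d) w)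
pathLap-kinked {P} {suc m} c E K d inj d<m slope w with path-hits? P (suc m) w
... | inj₂ misses
  rewrite pathLap-off P (suc m) c w misses | δ-off (misses 0 z≤n) | δ-off (misses (suc m) ℕₚ.≤-refl)
        | δ-off (misses (suc d) d<m) | δ-off (misses d (ℕₚ.<⇒≤ d<m)) = ring E K
  where
  ring : ∀ E K → 0ℤ + E * (0ℤ - 0ℤ) ≡ K * (0ℤ - 0ℤ)
  ring = solve-∀
... | inj₁ (r , r≤m , refl) =
  trans (cong₂ (λ x y → pathLap P (suc m) c (P r) + E * (x - y))
               (δ-injective inj z≤n r≤m) (δ-injective inj ℕₚ.≤-refl r≤m))
  (trans (on-path r (position m r r≤m))
         (sym (cong₂ (λ x y → K * (x - y)) (δ-injective inj d<m r≤m) (δ-injective inj (ℕₚ.<⇒≤ d<m) r≤m))))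
  where
  on-path : ∀ r → Position (suc m) r →
    pathLap P (suc m) c (P r) + E * (δ 0 r - δ (suc m) r) ≡ K * (δ (suc d) r - δ d r)
  on-path .0 first rewrite pathLap-first inj c | slope 0 (s≤s z≤n) = ring (c (P 0)) E K (δ d 0)
    where
    ring : ∀ a E K x → a - (a + (E + x * K)) + E * (1ℤ - 0ℤ) ≡ K * (0ℤ - x)
    ring = solve-∀
  on-path .(suc r) (inner {r = r} 1+r<1+m)
    rewrite pathLap-inner inj c r 1+r<1+m | slope (suc r) 1+r<1+m | slope r (ℕₚ.<-trans (ℕₚ.n<1+n r) 1+r<1+m)
          | δ-off {m} {r} (ℕₚ.>⇒≢ (ℕₚ.≤-pred 1+r<1+m))
    = ring (c (P r)) E K (δ d r) (δ d (suc r))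
    where
    ring : ∀ a E K x y →
      a + (E + x * K) - (a + (E + x * K) + (E + y * K)) + (a + (E + x * K) - a) + E * (0ℤ - 0ℤ) ≡ K * (x - y)
    ring = solve-∀
  on-path .(suc m) last rewrite pathLap-last inj c | slope m ℕₚ.≤-refl | δ-diag m | δ-off {d} {suc m} (ℕₚ.<⇒≢ d<m)
    = ring (c (P m)) E K (δ d m)
    where
    ring : ∀ a E K x → a + (E + x * K) - a + E * (0ℤ - 1ℤ) ≡ K * (x - 0ℤ)
    ring = solve-∀

δ-path-off : ∀ {P m} → InjectiveUpTo P m → ∀ {s r} → s ≤ m → r ≤ m → s ≢ r → δ (P s) (P r) ≡ 0ℤ
δ-path-off inj s≤m r≤m s≢r = trans (δ-injective inj s≤m r≤m) (δ-off s≢r)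

n≢2+n : ∀ n → n ≢ suc (suc n)
n≢2+n n = ℕₚ.<⇒≢ (s≤s (ℕₚ.n≤1+n n))

pathLap-δ-next : ∀ {P m} → InjectiveUpTo P m → ∀ t → suc t ≤ m → pathLap P m (δ (P t)) (P (suc t)) ≡ -1ℤ
pathLap-δ-next {P} {m} inj t t<m with ℕₚ.m≤n⇒m<n∨m≡n t<m
... | inj₁ 1+t<m
  rewrite pathLap-inner inj (δ (P t)) t 1+t<m | δ-path-off inj (ℕₚ.<⇒≤ t<m) t<m (≢-sym ℕₚ.1+n≢n)
        | δ-path-off inj (ℕₚ.<⇒≤ t<m) 1+t<m (n≢2+n t) | δ-diag (P t) = refl
... | inj₂ refl
  rewrite pathLap-last inj (δ (P t)) | δ-path-off inj (ℕₚ.<⇒≤ t<m) t<m (≢-sym ℕₚ.1+n≢n) | δ-diag (P t) = refl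

pathLap-δ-prev : ∀ {P m} → InjectiveUpTo P m → ∀ t → suc t ≤ m → pathLap P m (δ (P (suc t))) (P t) ≡ -1ℤ
pathLap-δ-prev {P} {suc m} inj zero 1≤m
  rewrite pathLap-first inj (δ (P 1)) | δ-path-off inj 1≤m z≤n ℕₚ.1+n≢n | δ-diag (P 1) = refl
pathLap-δ-prev {P} {m} inj (suc t) 2+t≤m
  rewrite pathLap-inner inj (δ (P (suc (suc t)))) t 2+t≤m
        | δ-path-off inj 2+t≤m (ℕₚ.<⇒≤ 2+t≤m) ℕₚ.1+n≢n
        | δ-path-off inj 2+t≤m (ℕₚ.≤-trans (ℕₚ.n≤1+n t) (ℕₚ.<⇒≤ 2+t≤m)) (≢-sym (n≢2+n t))
        | δ-diag (P (suc (suc t))) = refl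

pathLap-δ-far : ∀ {P m} → InjectiveUpTo P m → ∀ t r → t ≤ m → r ≤ m → r ≢ t → r ≢ suc t → t ≢ suc r →
  pathLap P m (δ (P t)) (P r) ≡ 0ℤ
pathLap-δ-far {P} {zero}  inj t zero t≤m r≤m _ _ _ = refl
pathLap-δ-far {P} {suc m} inj t zero t≤m r≤m 0≢t _ t≢1
  rewrite pathLap-first inj (δ (P t)) | δ-path-off inj t≤m z≤n (≢-sym 0≢t) | δ-path-off inj t≤m (s≤s z≤n) t≢1
  = refl
pathLap-δ-far {P} {m} inj t (suc r) t≤m r<m r+1≢t r+1≢t+1 t≢r+2 with ℕₚ.m≤n⇒m<n∨m≡n r<m
... | inj₁ r+1<m
  rewrite pathLap-inner inj (δ (P t)) r r+1<m | δ-path-off inj t≤m r<m (≢-sym r+1≢t)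
        | δ-path-off inj t≤m r+1<m t≢r+2 | δ-path-off inj t≤m (ℕₚ.≤-trans (ℕₚ.n≤1+n r) r<m) (λ t≡r → r+1≢t+1 (cong suc (sym t≡r)))
  = refl
... | inj₂ refl
  rewrite pathLap-last inj (δ (P t)) | δ-path-off inj t≤m r<m (≢-sym r+1≢t)
        | δ-path-off inj t≤m (ℕₚ.n≤1+n r) (λ t≡r → r+1≢t+1 (cong suc (sym t≡r)))
  = refl

module PathFiring (es : List Edge) (Nt : ℕ) (es<Nt : EdgesIn (_< Nt) es) (c : ℕ → ℤ) (y₀ : ℕ) where
  open Firing es Nt
  open Collapse es<Nt c y₀

  module _ (P : ℕ → ℕ) (m d : ℕ) (inj : InjectiveUpTo P m) (d<m : suc d ≤ m) (P<Nt : ∀ t → t ≤ m → P t < Nt)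
    (harmonic : ∀ t → t ≤ m → t ≢ d → t ≢ suc d → lap es c (P t) ≡ 0ℤ)
    (local : ∀ t → t ≤ m → t ≢ d → t ≢ suc d → ∀ u → u < Nt →
             Collapsible u ⊎ lap es (δ (P t)) u ≡ pathLap P m (δ (P t)) u)
    where

    collapsible-next : ∀ t → suc t ≤ m → t ≢ d → t ≢ suc d → (∀ r → r ≤ t → Collapsible (P r)) →
      Collapsible (P (suc t))
    collapsible-next t t<m t≢d t≢d+1 before with local t (ℕₚ.<⇒≤ t<m) t≢d t≢d+1 (P (suc t)) (P<Nt (suc t) t<m)
    ... | inj₁ collapsible = collapsible
    ... | inj₂ on-path = collapsible-by-firing (P t) (P<Nt t (ℕₚ.<⇒≤ t<m)) (harmonic t (ℕₚ.<⇒≤ t<m) t≢d t≢d+1)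
                           (P (suc t)) (P<Nt (suc t) t<m) (trans on-path (pathLap-δ-next inj t t<m)) others
      where
      others : ∀ u → u < Nt → u ≢ P (suc t) → lap es (δ (P t)) u ≡ 0ℤ ⊎ Collapsible u
      others u u<Nt u≢next with local t (ℕₚ.<⇒≤ t<m) t≢d t≢d+1 u u<Nt
      ... | inj₁ collapsible = inj₂ collapsible
      ... | inj₂ eq with path-hits? P m u
      ...   | inj₂ misses = inj₁ (trans eq (pathLap-off P m (δ (P t)) u misses))
      ...   | inj₁ (r , r≤m , refl) with r ℕₚ.≤? t
      ...     | yes r≤t = inj₂ (before r r≤t)
      ...     | no  r≰t = inj₁ (trans eq (pathLap-δ-far inj t r (ℕₚ.<⇒≤ t<m) r≤m (ℕₚ.>⇒≢ t<r)
                            (λ r≡t+1 → u≢next (cong P r≡t+1)) (ℕₚ.<⇒≢ (ℕₚ.<-trans t<r (ℕₚ.n<1+n r)))))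
        where
        t<r : t < r
        t<r = ℕₚ.≰⇒> r≰t

    collapsible-prev : ∀ t → suc t ≤ m → suc t ≢ d → suc t ≢ suc d →
      (∀ r → suc t ≤ r → r ≤ m → Collapsible (P r)) → Collapsible (P t)
    collapsible-prev t t<m t+1≢d t+1≢d+1 after with local (suc t) t<m t+1≢d t+1≢d+1 (P t) (P<Nt t (ℕₚ.<⇒≤ t<m))
    ... | inj₁ collapsible = collapsible
    ... | inj₂ on-path = collapsible-by-firing (P (suc t)) (P<Nt (suc t) t<m) (harmonic (suc t) t<m t+1≢d t+1≢d+1)
                           (P t) (P<Nt t (ℕₚ.<⇒≤ t<m)) (trans on-path (pathLap-δ-prev inj t t<m)) others
      where
      others : ∀ u → u < Nt → u ≢ P t → lap es (δ (P (suc t))) u ≡ 0ℤ ⊎ Collapsible u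
      others u u<Nt u≢prev with local (suc t) t<m t+1≢d t+1≢d+1 u u<Nt
      ... | inj₁ collapsible = inj₂ collapsible
      ... | inj₂ eq with path-hits? P m u
      ...   | inj₂ misses = inj₁ (trans eq (pathLap-off P m (δ (P (suc t))) u misses))
      ...   | inj₁ (r , r≤m , refl) with suc t ℕₚ.≤? r
      ...     | yes t<r = inj₂ (after r t<r r≤m)
      ...     | no  t≮r = inj₁ (trans eq (pathLap-δ-far inj (suc t) r t<m r≤m (ℕₚ.<⇒≢ r≤t)
                            (ℕₚ.<⇒≢ (ℕₚ.<-trans r≤t (ℕₚ.n<1+n (suc t))))
                            (λ t+1≡r+1 → u≢prev (cong P (sym (ℕₚ.suc-injective t+1≡r+1))))))
        where
        r≤t : r < suc t
        r≤t = ℕₚ.≰⇒> t≮r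

    collapsible-prefix : Collapsible (P 0) → ∀ t → t ≤ d → ∀ r → r ≤ t → Collapsible (P r)
    collapsible-prefix c₀ zero    _    zero _ = c₀
    collapsible-prefix c₀ (suc t) t<d r r≤t+1 with r ℕₚ.≟ suc t
    ... | no  r≢t+1 = collapsible-prefix c₀ t (ℕₚ.<⇒≤ t<d) r (ℕₚ.≤-pred (ℕₚ.≤∧≢⇒< r≤t+1 r≢t+1))
    ... | yes refl  = collapsible-next t (ℕₚ.≤-trans t<d (ℕₚ.<⇒≤ d<m)) (ℕₚ.<⇒≢ t<d)
                        (ℕₚ.<⇒≢ (ℕₚ.<-trans t<d (ℕₚ.n<1+n d)))
                        (collapsible-prefix c₀ t (ℕₚ.<⇒≤ t<d))

    collapsible-suffix : Collapsible (P m) → ∀ k j → j ℕ.+ k ≡ m → suc d ≤ j → ∀ r → j ≤ r → r ≤ m →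
      Collapsible (P r)
    collapsible-suffix cₘ zero j j≡m d<j r j≤r r≤m
      rewrite ℕₚ.+-identityʳ j | j≡m | ℕₚ.≤-antisym r≤m j≤r = cₘ
    collapsible-suffix cₘ (suc k) j j+k+1≡m d<j r j≤r r≤m with r ℕₚ.≟ j
    ... | no  r≢j  = collapsible-suffix cₘ k (suc j) (trans (sym (ℕₚ.+-suc j k)) j+k+1≡m) (ℕₚ.m≤n⇒m≤1+n d<j) r
                       (ℕₚ.≤∧≢⇒< j≤r (≢-sym r≢j)) r≤m
    ... | yes refl = collapsible-prev r r<m (ℕₚ.>⇒≢ (ℕₚ.m≤n⇒m≤1+n d<j)) (ℕₚ.>⇒≢ (s≤s d<j))
                       (collapsible-suffix cₘ k (suc r) (trans (sym (ℕₚ.+-suc r k)) j+k+1≡m) (ℕₚ.m≤n⇒m≤1+n d<j))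
      where
      r<m : suc r ≤ m
      r<m = subst (suc r ≤_) j+k+1≡m (ℕₚ.m<m+n r (s≤s z≤n))

    collapsible-path : Collapsible (P 0) → Collapsible (P m) → ∀ t → t ≤ m → Collapsible (P t)
    collapsible-path c₀ cₘ t t≤m with t ℕₚ.≤? d
    ... | yes t≤d = collapsible-prefix c₀ d ℕₚ.≤-refl t t≤d
    ... | no  t≰d = collapsible-suffix cₘ (m ∸ suc d) (suc d) (ℕₚ.m+[n∸m]≡n d<m) ℕₚ.≤-refl t (ℕₚ.≰⇒> t≰d) t≤m

-- The glued cycles of the chain

succMod-< : ∀ n t → suc t < n → succMod n t ≡ suc t
succMod-< n t t+1<n rewrite ≢⇒≡ᵇ-false (ℕₚ.<⇒≢ t+1<n) = refl

succMod-last : ∀ n → succMod (suc n) n ≡ 0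
succMod-last n rewrite ≡ᵇ-refl n = refl

lap-map-applyUpTo : ∀ (e : ℕ → Edge) (f : ℕ → ℕ) k z w →
  lap (map e (applyUpTo f k)) z w ≡ ∑< k (λ t → edgeLap (e (f t)) z w)
lap-map-applyUpTo e f zero    z w = refl
lap-map-applyUpTo e f (suc k) z w =
  trans (cong (_+_ (edgeLap (e (f 0)) z w)) (lap-map-applyUpTo e (λ x → f (suc x)) k z w))
        (sym (∑<-suc k (λ t → edgeLap (e (f t)) z w)))

All-map-applyUpTo : ∀ {Q : Edge → Set} (e : ℕ → Edge) f k → (∀ t → t < k → Q (e (f t))) →
  All Q (map e (applyUpTo f k))
All-map-applyUpTo e f k Qe = Allₚ.map⁺ (Allₚ.applyUpTo⁺₁ f k (λ {i} i<k → Qe i i<k))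

-- A cycle of length n glued along a — b becomes the path b, N, N+1, …, N+n-3, a
-- of length m = n - 1 through its n - 2 fresh vertices.
gluedPath : ℕ → ℕ → ℕ → ℕ → ℕ → ℕ
gluedPath N a b n t = embed (just (a , b)) N (succMod n t)

gluedPath-inner : ∀ N a b n t → suc (suc t) < n → gluedPath N a b n (suc t) ≡ N ℕ.+ t
gluedPath-inner N a b n t t+2<n rewrite succMod-< n (suc t) t+2<n = refl

gluedPath-last : ∀ N a b m → gluedPath N a b (suc m) m ≡ a
gluedPath-last N a b m rewrite succMod-last m = refl

lap-newEdges-glued : ∀ N a b m z w →
  lap (newEdges (just (a , b)) N (suc m)) z w ≡ pathLap (gluedPath N a b (suc m)) m z w
lap-newEdges-glued N a b m z w =
  trans (lap-map-applyUpTo (λ j → embed (just (a , b)) N j , embed (just (a , b)) N (succMod (suc m) j)) suc m z w)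
        (∑<-cong m (λ t t<m → cong (λ x → edgeLap (embed (just (a , b)) N x , gluedPath N a b (suc m) (suc t)) z w)
                                   (sym (succMod-< (suc m) t (s≤s t<m)))))

orient : Bool → ℕ → ℕ → ℕ × ℕ
orient true  x y = y , x
orient false x y = x , y

orient-both : ∀ (Q : ℕ → Set) f {x y} → Q x → Q y → Q (proj₁ (orient f x y)) × Q (proj₂ (orient f x y))
orient-both Q true  qx qy = qy , qx
orient-both Q false qx qy = qx , qy

orient-≢ : ∀ f {x y} → x ≢ y → proj₁ (orient f x y) ≢ proj₂ (orient f x y)
orient-≢ true  x≢y = ≢-sym x≢y
orient-≢ false x≢y = x≢y

Cycle : Set
Cycle = ℕ × ℕ × Bool

exitEdge : ℕ → ℕ → ℕ → Cycle → ℕ × ℕ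
exitEdge N a b (n , d , f) =
  if f then (embed (just (a , b)) N (succMod n d) , embed (just (a , b)) N d)
       else (embed (just (a , b)) N d , embed (just (a , b)) N (succMod n d))

build-∷ : ∀ N a b n d f cs → build N (just (a , b)) ((n , d , f) ∷ cs) ≡
  (proj₁ (build (N ℕ.+ (n ∸ 2)) (just (exitEdge N a b (n , d , f))) cs) ,
   newEdges (just (a , b)) N n ++ proj₂ (build (N ℕ.+ (n ∸ 2)) (just (exitEdge N a b (n , d , f))) cs))
build-∷ N a b n d true  cs = refl
build-∷ N a b n d false cs = refl

lastEdge : ℕ → ℕ → ℕ → List Cycle → ℕ × ℕ
lastEdge N a b []                = a , b
lastEdge N a b (cyc@(n , _) ∷ cs) =
  lastEdge (N ℕ.+ (n ∸ 2)) (proj₁ (exitEdge N a b cyc)) (proj₂ (exitEdge N a b cyc)) cs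

ValidTail : List Cycle → Set
ValidTail = All (λ (n , d , _) → 3 ≤ n × 1 ≤ d × d < n)

-- The potential enters a glued cycle with the values ca, cb at the ends of the
-- gluing edge a — b; along the path b ⋯ a it has slope E, plus one jump (the kink)
-- across the exit edge, chosen so that it arrives at ca.
record State : Set where
  constructor state
  field
    ca cb E : ℤ
open State public

kink : State → ℕ → ℤ
kink s n = ca s - cb s - + (n ∸ 1) * E s

potential : State → ℕ → ℕ → ℕ → ℤ
potential s n d t = cb s + + t * E s + (if d ≤ᵇ t then kink s n else 0ℤ)

nextState : State → ℕ → ℕ → Bool → State
nextState s n d true  = state (potential s n d d) (potential s n d (d ∸ 1)) (- kink s n)
nextState s n d false = state (potential s n d (d ∸ 1)) (potential s n d d) (kink s n)

nextState-values : ∀ (c : ℕ → ℤ) s n d f {x y} →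
  c x ≡ potential s n (suc d) d → c y ≡ potential s n (suc d) (suc d) →
  c (proj₁ (orient f x y)) ≡ ca (nextState s n (suc d) f) × c (proj₂ (orient f x y)) ≡ cb (nextState s n (suc d) f)
nextState-values c s n d true  cx cy = cy , cx
nextState-values c s n d false cx cy = cx , cy

kink-flux : ∀ s n d f x y w → kink s n * (δ y w - δ x w)
  ≡ E (nextState s n d f) * (δ (proj₂ (orient f x y)) w - δ (proj₁ (orient f x y)) w)
kink-flux s n d true  x y w = ring (kink s n) (δ y w) (δ x w)
  where
  ring : ∀ k y x → k * (y - x) ≡ (- k) * (x - y)
  ring = solve-∀
kink-flux s n d false x y w = refl

finalState : State → List Cycle → State
finalState s []                  = s
finalState s ((n , d , f) ∷ cs) = finalState (nextState s n d f) cs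

chainPotential : ℕ → State → List Cycle → ℕ → ℤ
chainPotential N s []                  w = 0ℤ
chainPotential N s ((n , d , f) ∷ cs) w =
  if w <ᵇ N ℕ.+ (n ∸ 2) then potential s n d (suc (w ∸ N))
                        else chainPotential (N ℕ.+ (n ∸ 2)) (nextState s n d f) cs w

potential-first : ∀ s n d → potential s n (suc d) 0 ≡ cb s
potential-first s n d = ring (cb s) (E s)
  where
  ring : ∀ b e → b + 0ℤ * e + 0ℤ ≡ b
  ring = solve-∀

potential-last : ∀ s n d → suc d ≤ n ∸ 1 → potential s n (suc d) (n ∸ 1) ≡ ca s
potential-last s n d d<n-1 rewrite <⇒<ᵇ-true d<n-1 = ring (ca s) (cb s) (+ (n ∸ 1)) (E s)
  where
  ring : ∀ a b m e → b + m * e + (a - b - m * e) ≡ a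
  ring = solve-∀

potential-step : ∀ s n d t → potential s n (suc d) (suc t) ≡ potential s n (suc d) t + (E s + δ d t * kink s n)
potential-step s n d t with ℕₚ.<-cmp t d
... | tri< t<d _ _ rewrite ≤⇒<ᵇ-false t<d | ≤⇒<ᵇ-false (ℕₚ.<⇒≤ t<d) | δ-off (ℕₚ.>⇒≢ t<d) =
  ring (cb s) (+ t) (E s) (kink s n)
  where
  ring : ∀ b t e k → b + (1ℤ + t) * e + 0ℤ ≡ b + t * e + 0ℤ + (e + 0ℤ * k)
  ring = solve-∀
... | tri≈ _ refl _ rewrite <⇒<ᵇ-true (ℕₚ.n<1+n t) | ≤⇒<ᵇ-false (ℕₚ.≤-refl {t}) | δ-diag t =
  ring (cb s) (+ t) (E s) (kink s n)
  where
  ring : ∀ b t e k → b + (1ℤ + t) * e + k ≡ b + t * e + 0ℤ + (e + 1ℤ * k)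
  ring = solve-∀
... | tri> _ _ d<t rewrite <⇒<ᵇ-true (ℕₚ.m<n⇒m<1+n d<t) | <⇒<ᵇ-true d<t | δ-off (ℕₚ.<⇒≢ d<t) =
  ring (cb s) (+ t) (E s) (kink s n)
  where
  ring : ∀ b t e k → b + (1ℤ + t) * e + k ≡ b + t * e + k + (e + 0ℤ * k)
  ring = solve-∀

potential-slope : ∀ {P : ℕ → ℕ} {m} (c : ℕ → ℤ) s n d → (∀ t → t ≤ m → c (P t) ≡ potential s n (suc d) t) →
  ∀ t → t < m → c (P (suc t)) ≡ c (P t) + (E s + δ d t * kink s n)
potential-slope {P} c s n d on-path t t<m =
  trans (on-path (suc t) t<m)
        (trans (potential-step s n d t) (cong (_+ (E s + δ d t * kink s n)) (sym (on-path t (ℕₚ.<⇒≤ t<m)))))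

Near : ℕ → ℕ → ℕ → ℕ → Set
Near N a b v = v ≡ a ⊎ v ≡ b ⊎ N ≤ v

fresh≢ : ∀ {N x} r → x < N → x ≢ N ℕ.+ r
fresh≢ {N} r x<N x≡N+r = ℕₚ.<⇒≱ x<N (subst (N ≤_) (sym x≡N+r) (ℕₚ.m≤m+n N r))

module GluedCycle (N a b k : ℕ) (a<N : a < N) (b<N : b < N) (a≢b : a ≢ b) where

  n m : ℕ
  n = suc (suc (suc k))
  m = suc (suc k)

  P : ℕ → ℕ
  P = gluedPath N a b n

  N′ : ℕ
  N′ = N ℕ.+ suc k

  inner-value : ∀ {r} → suc r < m → P (suc r) ≡ N ℕ.+ r
  inner-value r+1<m = gluedPath-inner N a b n _ (s≤s r+1<m)

  last-value : P m ≡ a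
  last-value = gluedPath-last N a b m

  injective : InjectiveUpTo P m
  injective s t s≤m t≤m Ps≡Pt = go (position (suc k) s s≤m) (position (suc k) t t≤m) Ps≡Pt
    where
    go : ∀ {s t} → Position m s → Position m t → P s ≡ P t → s ≡ t
    go first      first       _ = refl
    go first      (inner r<)  e = ⊥-elim (fresh≢ _ b<N (trans e (inner-value r<)))
    go first      last        e = ⊥-elim (a≢b (sym (trans e last-value)))
    go (inner r<) first       e = ⊥-elim (fresh≢ _ b<N (trans (sym e) (inner-value r<)))
    go (inner r<) (inner r′<) e =
      cong suc (ℕₚ.+-cancelˡ-≡ N _ _ (trans (sym (inner-value r<)) (trans e (inner-value r′<))))
    go (inner r<) last        e = ⊥-elim (fresh≢ _ a<N (trans (sym last-value) (trans (sym e) (inner-value r<))))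
    go last       first       e = ⊥-elim (a≢b (trans (sym last-value) e))
    go last       (inner r′<) e = ⊥-elim (fresh≢ _ a<N (trans (sym last-value) (trans e (inner-value r′<))))
    go last       last        _ = refl

  P<N′ : ∀ t → t ≤ m → P t < N′
  P<N′ t t≤m with position (suc k) t t≤m
  ... | first     = ℕₚ.<-≤-trans b<N (ℕₚ.m≤m+n N (suc k))
  ... | inner r<  rewrite inner-value r< = ℕₚ.+-monoʳ-< N (ℕₚ.≤-pred r<)
  ... | last      rewrite last-value = ℕₚ.<-≤-trans a<N (ℕₚ.m≤m+n N (suc k))

  newEdges-in : ∀ (Q : ℕ → Set) → (∀ t → t ≤ m → Q (P t)) → EdgesIn Q (newEdges (just (a , b)) N n)
  newEdges-in Q QP = All-map-applyUpTo (λ j → embed (just (a , b)) N j , embed (just (a , b)) N (succMod n j)) suc m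
    (λ t t<m → subst Q (cong (embed (just (a , b)) N) (succMod-< n t (s≤s t<m))) (QP t (ℕₚ.<⇒≤ t<m)) , QP (suc t) t<m)

  newEdges-loopless : NoLoop (newEdges (just (a , b)) N n)
  newEdges-loopless = All-map-applyUpTo (λ j → embed (just (a , b)) N j , embed (just (a , b)) N (succMod n j)) suc m
    (λ t t<m e → ℕₚ.1+n≢n (sym (injective t (suc t) (ℕₚ.<⇒≤ t<m) t<m
                   (trans (cong (embed (just (a , b)) N) (succMod-< n t (s≤s t<m))) e))))

  P-near : ∀ t → t ≤ m → Near N a b (P t)
  P-near t t≤m with position (suc k) t t≤m
  ... | first    = inj₂ (inj₁ refl)
  ... | inner r< = inj₂ (inj₂ (subst (N ≤_) (sym (inner-value r<)) (ℕₚ.m≤m+n N _)))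
  ... | last     = inj₁ last-value

  module Exit (d : ℕ) (d<m : suc d ≤ m) where

    exit≢ : P d ≢ P (suc d)
    exit≢ e = ℕₚ.1+n≢n (sym (injective d (suc d) (ℕₚ.<⇒≤ d<m) d<m e))

    exitEdge-orient : ∀ f → exitEdge N a b (n , suc d , f) ≡ orient f (P d) (P (suc d))
    exitEdge-orient true  = cong (P (suc d) ,_) (cong (embed (just (a , b)) N) (sym (succMod-< n d (s≤s d<m))))
    exitEdge-orient false = cong (_, P (suc d)) (cong (embed (just (a , b)) N) (sym (succMod-< n d (s≤s d<m))))

    exit-both : ∀ (Q : ℕ → Set) f → Q (P d) → Q (P (suc d)) →
      Q (proj₁ (exitEdge N a b (n , suc d , f))) × Q (proj₂ (exitEdge N a b (n , suc d , f)))
    exit-both Q f Qd Qd+1 =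
      subst (λ e → Q (proj₁ e) × Q (proj₂ e)) (sym (exitEdge-orient f)) (orient-both Q f Qd Qd+1)

    exit-ends≢ : ∀ f → proj₁ (exitEdge N a b (n , suc d , f)) ≢ proj₂ (exitEdge N a b (n , suc d , f))
    exit-ends≢ f = subst (λ e → proj₁ e ≢ proj₂ e) (sym (exitEdge-orient f)) (orient-≢ f exit≢)

    exit-away : ∀ f t → t ≤ m → t ≢ d → t ≢ suc d →
      P t ≢ proj₁ (exitEdge N a b (n , suc d , f)) × P t ≢ proj₂ (exitEdge N a b (n , suc d , f))
    exit-away f t t≤m t≢d t≢d+1 =
      exit-both (P t ≢_) f (λ e → t≢d (injective t d t≤m (ℕₚ.<⇒≤ d<m) e)) (λ e → t≢d+1 (injective t (suc d) t≤m d<m e))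

  module _ (s : State) (d : ℕ) (f : Bool) (cs : List Cycle) (c : ℕ → ℤ)
    (ca≡ : c a ≡ ca s) (cb≡ : c b ≡ cb s) (fresh : ∀ w → N ≤ w → c w ≡ chainPotential N s ((n , suc d , f) ∷ cs) w)
    where

    potential-on-path : suc d ≤ m → ∀ t → t ≤ m → c (P t) ≡ potential s n (suc d) t
    potential-on-path d<m t t≤m with position (suc k) t t≤m
    ... | first = trans cb≡ (sym (potential-first s n d))
    ... | last  = trans (cong c last-value) (trans ca≡ (sym (potential-last s n d d<m)))
    ... | inner {r = r} r+1<m rewrite inner-value r+1<m | fresh (N ℕ.+ r) (ℕₚ.m≤m+n N r)
                                    | <⇒<ᵇ-true (ℕₚ.+-monoʳ-< N (ℕₚ.≤-pred r+1<m)) | ℕₚ.m+n∸m≡n N r = refl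

    potential-beyond : ∀ w → N′ ≤ w → c w ≡ chainPotential N′ (nextState s n (suc d) f) cs w
    potential-beyond w N′≤w rewrite fresh w (ℕₚ.≤-trans (ℕₚ.m≤m+n N (suc k)) N′≤w) | ≤⇒<ᵇ-false N′≤w = refl

lap-tail : ∀ cs N a b s → ValidTail cs → a < N → b < N → a ≢ b → (c : ℕ → ℤ) →
  c a ≡ ca s → c b ≡ cb s → (∀ w → N ≤ w → c w ≡ chainPotential N s cs w) → ∀ w →
  lap (proj₂ (build N (just (a , b)) cs)) c w + E s * (δ b w - δ a w)
  ≡ E (finalState s cs) * (δ (proj₂ (lastEdge N a b cs)) w - δ (proj₁ (lastEdge N a b cs)) w)
lap-tail [] N a b s _ _ _ _ c _ _ _ w = ℤₚ.+-identityˡ _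
lap-tail ((.(suc (suc (suc k))) , .(suc d) , f) ∷ cs) N a b s
         ((s≤s (s≤s (s≤s {n = k} _)) , s≤s {n = d} z≤n , d<n) ∷ valid) a<N b<N a≢b c ca≡ cb≡ fresh w
  rewrite build-∷ N a b (suc (suc (suc k))) (suc d) f cs
        | lap-++ (newEdges (just (a , b)) N (suc (suc (suc k)))) (proj₂ (build (N ℕ.+ suc k) (just (exitEdge N a b (suc (suc (suc k)) , suc d , f))) cs)) c w
        | lap-newEdges-glued N a b (suc (suc k)) c w
  = begin
    pathLap P m c w + lap rest c w + E s * (δ b w - δ a w)
      ≡⟨ ring (pathLap P m c w) (lap rest c w) (E s * (δ b w - δ a w)) ⟩
    lap rest c w + (pathLap P m c w + E s * (δ (P 0) w - δ a w))
      ≡⟨ cong (λ x → lap rest c w + (pathLap P m c w + E s * (δ (P 0) w - δ x w))) (sym last-value) ⟩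
    lap rest c w + (pathLap P m c w + E s * (δ (P 0) w - δ (P m) w))
      ≡⟨ cong (_+_ (lap rest c w)) (pathLap-kinked c (E s) (kink s n) d injective d<m slope w) ⟩
    lap rest c w + kink s n * (δ (P (suc d)) w - δ (P d) w)
      ≡⟨ cong (_+_ (lap rest c w)) flux ⟩
    lap rest c w + E s′ * (δ (proj₂ a′b′) w - δ (proj₁ a′b′) w)
      ≡⟨ lap-tail cs N′ (proj₁ a′b′) (proj₂ a′b′) s′ valid (proj₁ a′b′<N′) (proj₂ a′b′<N′) (exit-ends≢ f) c
                  (proj₁ c-a′b′) (proj₂ c-a′b′) (potential-beyond s d f cs c ca≡ cb≡ fresh) w ⟩
    E (finalState s′ cs) * (δ (proj₂ (lastEdge N′ (proj₁ a′b′) (proj₂ a′b′) cs)) w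
                          - δ (proj₁ (lastEdge N′ (proj₁ a′b′) (proj₂ a′b′) cs)) w) ∎
  where
  open ≡-Reasoning
  open GluedCycle N a b k a<N b<N a≢b
  d<m : suc d ≤ m
  d<m = ℕₚ.≤-pred d<n
  open Exit d d<m
  a′b′ : ℕ × ℕ
  a′b′ = exitEdge N a b (n , suc d , f)
  s′ : State
  s′ = nextState s n (suc d) f
  rest : List Edge
  rest = proj₂ (build N′ (just a′b′) cs)
  ring : ∀ p r e → p + r + e ≡ r + (p + e)
  ring = solve-∀
  on-path : ∀ t → t ≤ m → c (P t) ≡ potential s n (suc d) t
  on-path = potential-on-path s d f cs c ca≡ cb≡ fresh d<m
  slope : ∀ t → t < m → c (P (suc t)) ≡ c (P t) + (E s + δ d t * kink s n)
  slope = potential-slope c s n d on-path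
  flux : kink s n * (δ (P (suc d)) w - δ (P d) w) ≡ E s′ * (δ (proj₂ a′b′) w - δ (proj₁ a′b′) w)
  flux = subst (λ e → kink s n * (δ (P (suc d)) w - δ (P d) w) ≡ E s′ * (δ (proj₂ e) w - δ (proj₁ e) w))
               (sym (exitEdge-orient f)) (kink-flux s n (suc d) f (P d) (P (suc d)) w)
  a′b′<N′ : proj₁ a′b′ < N′ × proj₂ a′b′ < N′
  a′b′<N′ = exit-both (_< N′) f (P<N′ d (ℕₚ.<⇒≤ d<m)) (P<N′ (suc d) d<m)
  c-a′b′ : c (proj₁ a′b′) ≡ ca s′ × c (proj₂ a′b′) ≡ cb s′
  c-a′b′ = subst (λ e → c (proj₁ e) ≡ ca s′ × c (proj₂ e) ≡ cb s′) (sym (exitEdge-orient f))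
                 (nextState-values c s n d f (on-path d (ℕₚ.<⇒≤ d<m)) (on-path (suc d) d<m))

record TailShape (N a b : ℕ) (G : Graph) (ℓ : ℕ × ℕ) : Set where
  field
    N≤size     : N ≤ proj₁ G
    edges-near : EdgesIn (λ v → Near N a b v × v < proj₁ G) (proj₂ G)
    loopless   : NoLoop (proj₂ G)
    last-near  : Near N a b (proj₁ ℓ) × Near N a b (proj₂ ℓ)
    last<size  : proj₁ ℓ < proj₁ G × proj₂ ℓ < proj₁ G
    last≢      : proj₁ ℓ ≢ proj₂ ℓ

tail-shape : ∀ cs N a b → ValidTail cs → a < N → b < N → a ≢ b →
  TailShape N a b (build N (just (a , b)) cs) (lastEdge N a b cs)
tail-shape [] N a b _ a<N b<N a≢b = record
  { N≤size = ℕₚ.≤-refl ; edges-near = [] ; loopless = []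
  ; last-near = inj₁ refl , inj₂ (inj₁ refl) ; last<size = a<N , b<N ; last≢ = a≢b }
tail-shape ((.(suc (suc (suc k))) , .(suc d) , f) ∷ cs) N a b
           ((s≤s (s≤s (s≤s {n = k} _)) , s≤s {n = d} z≤n , d<n) ∷ valid) a<N b<N a≢b =
  subst (λ G → TailShape N a b G (lastEdge N a b ((n , suc d , f) ∷ cs)))
        (sym (build-∷ N a b n (suc d) f cs)) record
    { N≤size     = ℕₚ.≤-trans (ℕₚ.m≤m+n N (suc k)) N≤size
    ; edges-near = Allₚ.++⁺ (newEdges-in _ (λ t t≤m → P-near t t≤m , ℕₚ.<-≤-trans (P<N′ t t≤m) N≤size))
                            (All.map (λ ((v-near , v<) , (w-near , w<)) → (widen v-near , v<) , (widen w-near , w<))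
                                     edges-near)
    ; loopless   = Allₚ.++⁺ newEdges-loopless loopless
    ; last-near  = widen (proj₁ last-near) , widen (proj₂ last-near)
    ; last<size  = last<size
    ; last≢      = last≢
    }
  where
  open GluedCycle N a b k a<N b<N a≢b
  d<m : suc d ≤ m
  d<m = ℕₚ.≤-pred d<n
  open Exit d d<m
  a′b′ : ℕ × ℕ
  a′b′ = exitEdge N a b (n , suc d , f)
  a′b′<N′ : proj₁ a′b′ < N′ × proj₂ a′b′ < N′
  a′b′<N′ = exit-both (_< N′) f (P<N′ d (ℕₚ.<⇒≤ d<m)) (P<N′ (suc d) d<m)
  open TailShape (tail-shape cs N′ (proj₁ a′b′) (proj₂ a′b′) valid (proj₁ a′b′<N′) (proj₂ a′b′<N′) (exit-ends≢ f))
  a′b′-near : Near N a b (proj₁ a′b′) × Near N a b (proj₂ a′b′)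
  a′b′-near = exit-both (Near N a b) f (P-near d (ℕₚ.<⇒≤ d<m)) (P-near (suc d) d<m)
  widen : ∀ {v} → Near N′ (proj₁ a′b′) (proj₂ a′b′) v → Near N a b v
  widen (inj₁ refl)        = proj₁ a′b′-near
  widen (inj₂ (inj₁ refl)) = proj₂ a′b′-near
  widen (inj₂ (inj₂ N′≤v)) = inj₂ (inj₂ (ℕₚ.≤-trans (ℕₚ.m≤m+n N (suc k)) N′≤v))

-- The states along the chain follow the recurrence: entering a cycle of length n
-- with (Y, X) = (x_{i-2}, x_{i-1}) it leaves with (X, n X - Y), up to a sign σ.
record Invariant (s : State) (Y X : ℤ) : Set where
  constructor invariant
  field
    σ    : ℤ
    unit : σ ≡ 1ℤ ⊎ σ ≡ -1ℤ
    ends : cb s - ca s ≡ σ * (X - Y)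
    flux : E s ≡ σ * X

invariant-next : ∀ s Y X k d f → suc d ≤ suc (suc k) → Invariant s Y X →
  Invariant (nextState s (suc (suc (suc k))) (suc d) f) X (+ suc (suc (suc k)) * X - Y)
invariant-next s Y X k d f d<m (invariant σ unit ends flux) = go f
  where
  n : ℕ
  n = suc (suc (suc k))
  ca≡ : ca s ≡ cb s - σ * (X - Y)
  ca≡ = trans (ring (ca s) (cb s)) (cong (_-_ (cb s)) ends)
    where
    ring : ∀ a b → a ≡ b - (b - a)
    ring = solve-∀
  at-d : potential s n (suc d) d ≡ cb s + + d * (σ * X)
  at-d rewrite ≤⇒<ᵇ-false (ℕₚ.≤-refl {d}) | flux = ℤₚ.+-identityʳ _
  at-d+1 : potential s n (suc d) (suc d)
           ≡ cb s + (1ℤ + + d) * (σ * X) + (cb s - σ * (X - Y) - cb s - + suc (suc k) * (σ * X))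
  at-d+1 rewrite <⇒<ᵇ-true (ℕₚ.n<1+n d) | flux | ca≡ = refl
  kink≡ : kink s n ≡ cb s - σ * (X - Y) - cb s - + suc (suc k) * (σ * X)
  kink≡ rewrite flux | ca≡ = refl
  go : ∀ f → Invariant (nextState s n (suc d) f) X (+ n * X - Y)
  go true = invariant σ unit (trans (cong₂ _-_ at-d at-d+1) (ring (cb s) σ X Y (+ d) (+ suc (suc k))))
                             (trans (cong -_ kink≡) (ring′ (cb s) σ X Y (+ suc (suc k))))
    where
    ring : ∀ b σ X Y d m → b + d * (σ * X) - (b + (1ℤ + d) * (σ * X) + (b - σ * (X - Y) - b - m * (σ * X)))
                         ≡ σ * ((1ℤ + m) * X - Y - X)
    ring = solve-∀
    ring′ : ∀ b σ X Y m → - (b - σ * (X - Y) - b - m * (σ * X)) ≡ σ * ((1ℤ + m) * X - Y)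
    ring′ = solve-∀
  go false = invariant (- σ) (flip unit) (trans (cong₂ _-_ at-d+1 at-d) (ring (cb s) σ X Y (+ d) (+ suc (suc k))))
                                         (trans kink≡ (ring′ (cb s) σ X Y (+ suc (suc k))))
    where
    flip : σ ≡ 1ℤ ⊎ σ ≡ -1ℤ → - σ ≡ 1ℤ ⊎ - σ ≡ -1ℤ
    flip (inj₁ refl) = inj₂ refl
    flip (inj₂ refl) = inj₁ refl
    ring : ∀ b σ X Y d m → b + (1ℤ + d) * (σ * X) + (b - σ * (X - Y) - b - m * (σ * X)) - (b + d * (σ * X))
                         ≡ (- σ) * ((1ℤ + m) * X - Y - X)
    ring = solve-∀
    ring′ : ∀ b σ X Y m → b - σ * (X - Y) - b - m * (σ * X) ≡ (- σ) * ((1ℤ + m) * X - Y)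
    ring′ = solve-∀

finalState-flux : ∀ cs s Y X → ValidTail cs → Invariant s Y X →
  Σ ℤ λ σ → (σ ≡ 1ℤ ⊎ σ ≡ -1ℤ) × E (finalState s cs) ≡ σ * xGo Y X (map proj₁ cs)
finalState-flux [] s Y X _ (invariant σ unit _ flux) = σ , unit , flux
finalState-flux ((.(suc (suc (suc k))) , .(suc d) , f) ∷ cs) s Y X
                ((s≤s (s≤s (s≤s {n = k} _)) , s≤s {n = d} z≤n , d<n) ∷ valid) inv =
  finalState-flux cs _ X (+ suc (suc (suc k)) * X - Y) valid (invariant-next s Y X k d f (ℕₚ.≤-pred d<n) inv)

module TailFiring (es : List Edge) (Nt : ℕ) (es<Nt : EdgesIn (_< Nt) es) (c : ℕ → ℤ) (y₀ : ℕ) where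
  open Firing es Nt
  open Collapse es<Nt c y₀
  open PathFiring es Nt es<Nt c y₀

  collapsible-tail : ∀ cs N a b → ValidTail cs → a < N → b < N → a ≢ b →
    proj₁ (build N (just (a , b)) cs) ≡ Nt →
    ∀ pre → EdgesIn (_< N) pre → es ≡ pre ++ proj₂ (build N (just (a , b)) cs) →
    (∀ y → y < Nt → y ≢ proj₁ (lastEdge N a b cs) → y ≢ proj₂ (lastEdge N a b cs) → lap es c y ≡ 0ℤ) →
    (∀ u → u < N → Collapsible u) →
    ∀ u → u < Nt → Collapsible u
  collapsible-tail [] N a b _ _ _ _ refl pre _ _ _ known = known
  collapsible-tail ((.(suc (suc (suc k))) , .(suc d) , f) ∷ cs) N a b
                   ((s≤s (s≤s (s≤s {n = k} _)) , s≤s {n = d} z≤n , d<n) ∷ valid) a<N b<N a≢b size≡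
                   pre pre<N es≡ harmonic known =
    collapsible-tail cs N′ (proj₁ a′b′) (proj₂ a′b′) valid (proj₁ a′b′<N′) (proj₂ a′b′<N′) (exit-ends≢ f)
      size′≡ (pre ++ cycle) pre′<N′ es≡′ harmonic known′
    where
    open GluedCycle N a b k a<N b<N a≢b
    d<m : suc d ≤ m
    d<m = ℕₚ.≤-pred d<n
    open Exit d d<m
    a′b′ : ℕ × ℕ
    a′b′ = exitEdge N a b (n , suc d , f)
    a′b′<N′ : proj₁ a′b′ < N′ × proj₂ a′b′ < N′
    a′b′<N′ = exit-both (_< N′) f (P<N′ d (ℕₚ.<⇒≤ d<m)) (P<N′ (suc d) d<m)
    cycle rest : List Edge
    cycle = newEdges (just (a , b)) N n
    rest  = proj₂ (build N′ (just a′b′) cs)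
    size′≡ : proj₁ (build N′ (just a′b′) cs) ≡ Nt
    size′≡ = trans (cong proj₁ (sym (build-∷ N a b n (suc d) f cs))) size≡
    es≡′ : es ≡ (pre ++ cycle) ++ rest
    es≡′ = trans es≡ (trans (cong (λ G → pre ++ proj₂ G) (build-∷ N a b n (suc d) f cs)) (sym (Listₚ.++-assoc pre cycle rest)))
    pre′<N′ : EdgesIn (_< N′) (pre ++ cycle)
    pre′<N′ = Allₚ.++⁺ (All.map (λ (p<N , q<N) → ℕₚ.<-≤-trans p<N (ℕₚ.m≤m+n N (suc k)) , ℕₚ.<-≤-trans q<N (ℕₚ.m≤m+n N (suc k))) pre<N)
                       (newEdges-in (_< N′) P<N′)
    open TailShape (tail-shape cs N′ (proj₁ a′b′) (proj₂ a′b′) valid (proj₁ a′b′<N′) (proj₂ a′b′<N′) (exit-ends≢ f))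
    P<Nt : ∀ t → t ≤ m → P t < Nt
    P<Nt t t≤m = subst (P t <_) size′≡ (ℕₚ.<-≤-trans (P<N′ t t≤m) N≤size)
    away : ∀ t → t ≤ m → t ≢ d → t ≢ suc d → ∀ {v} → Near N′ (proj₁ a′b′) (proj₂ a′b′) v → P t ≢ v
    away t t≤m t≢d t≢d+1 (inj₁ refl)        = proj₁ (exit-away f t t≤m t≢d t≢d+1)
    away t t≤m t≢d t≢d+1 (inj₂ (inj₁ refl)) = proj₂ (exit-away f t t≤m t≢d t≢d+1)
    away t t≤m t≢d t≢d+1 (inj₂ (inj₂ N′≤v)) Pt≡v = ℕₚ.<⇒≱ (P<N′ t t≤m) (subst (N′ ≤_) (sym Pt≡v) N′≤v)
    harmonic-path : ∀ t → t ≤ m → t ≢ d → t ≢ suc d → lap es c (P t) ≡ 0ℤ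
    harmonic-path t t≤m t≢d t≢d+1 =
      harmonic (P t) (P<Nt t t≤m) (away t t≤m t≢d t≢d+1 (proj₁ last-near)) (away t t≤m t≢d t≢d+1 (proj₂ last-near))
    local : ∀ t → t ≤ m → t ≢ d → t ≢ suc d → ∀ u → u < Nt →
            Collapsible u ⊎ lap es (δ (P t)) u ≡ pathLap P m (δ (P t)) u
    local t t≤m t≢d t≢d+1 u u<Nt with u ℕₚ.<? N
    ... | yes u<N = inj₁ (known u u<N)
    ... | no  u≮N = inj₂ (begin
      lap es (δ (P t)) u
        ≡⟨ cong (λ es → lap es (δ (P t)) u) es≡′ ⟩
      lap ((pre ++ cycle) ++ rest) (δ (P t)) u
        ≡⟨ trans (lap-++ (pre ++ cycle) rest (δ (P t)) u) (cong (_+ lap rest (δ (P t)) u) (lap-++ pre cycle (δ (P t)) u)) ⟩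
      lap pre (δ (P t)) u + lap cycle (δ (P t)) u + lap rest (δ (P t)) u
        ≡⟨ cong₂ (λ x y → x + lap cycle (δ (P t)) u + y) pre-away rest-vanishes ⟩
      0ℤ + lap cycle (δ (P t)) u + 0ℤ
        ≡⟨ trans (ℤₚ.+-identityʳ _) (trans (ℤₚ.+-identityˡ _) (lap-newEdges-glued N a b m (δ (P t)) u)) ⟩
      pathLap P m (δ (P t)) u ∎)
      where
      open ≡-Reasoning
      pre-away : lap pre (δ (P t)) u ≡ 0ℤ
      pre-away = lap-away pre (δ (P t)) u
        (All.map (λ (p<N , q<N) → (λ p≡u → u≮N (subst (_< N) p≡u p<N)) , (λ q≡u → u≮N (subst (_< N) q≡u q<N))) pre<N)
      rest-vanishes : lap rest (δ (P t)) u ≡ 0ℤ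
      rest-vanishes = lap-vanishing rest (δ (P t)) u
        (All.map (λ ((v-near , _) , (w-near , _)) → δ-off (away t t≤m t≢d t≢d+1 v-near) , δ-off (away t t≤m t≢d t≢d+1 w-near))
                 edges-near)
    collapsible-P : ∀ t → t ≤ m → Collapsible (P t)
    collapsible-P = collapsible-path P m d injective d<m P<Nt harmonic-path local
      (known b b<N) (subst Collapsible (sym last-value) (known a a<N))
    known′ : ∀ u → u < N′ → Collapsible u
    known′ u u<N′ with u ℕₚ.<? N
    ... | yes u<N = known u u<N
    ... | no  u≮N = subst Collapsible (trans (inner-value j+1<m) (ℕₚ.m+[n∸m]≡n N≤u)) (collapsible-P (suc j) (ℕₚ.<⇒≤ j+1<m))
      where
      N≤u : N ≤ u
      N≤u = ℕₚ.≮⇒≥ u≮N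
      j : ℕ
      j = u ∸ N
      j+1<m : suc j < m
      j+1<m = s≤s (ℕₚ.+-cancelˡ-< N j (suc k) (subst (_< N ℕ.+ suc k) (sym (ℕₚ.m+[n∸m]≡n N≤u)) u<N′))

-- The first cycle

build-first : ∀ n d f rest → build 0 nothing ((n , d , f) ∷ rest) ≡
  (proj₁ (build n (just (orient f d (succMod n d))) rest) ,
   newEdges nothing 0 n ++ proj₂ (build n (just (orient f d (succMod n d))) rest))
build-first n d true  rest = refl
build-first n d false rest = refl

xSeq-∷ : ∀ n ns → xSeq (n ∷ ns) ≡ xGo 1ℤ (+ n * 1ℤ - 0ℤ) ns
xSeq-∷ n []       = ring (+ n)
  where
  ring : ∀ x → x ≡ x * 1ℤ - 0ℤ
  ring = solve-∀
xSeq-∷ n (n₂ ∷ ns) = cong₂ (λ p q → xGo p q ns) (ring (+ n)) (ring′ (+ n) (+ n₂))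
  where
  ring : ∀ x → x ≡ x * 1ℤ - 0ℤ
  ring = solve-∀
  ring′ : ∀ x y → x * y - 1ℤ ≡ y * (x * 1ℤ - 0ℤ) - 1ℤ
  ring′ = solve-∀

-- The first cycle is traversed as a path P 0, …, P m through all its vertices,
-- closed by the edge P m — P 0, whose endpoints are the sink 0 and the
-- generator y₀; the potential c₁ has slope E s₀ along it and jumps at the exit edge.
module FirstCycle (k d : ℕ) (d<m : suc d ≤ suc (suc k)) (d₁ : ℕ) (f₁ : Bool)
  (rest : List Cycle) (valid : ValidTail rest)
  (P : ℕ → ℕ) (injective : InjectiveUpTo P (suc (suc k)))
  (P<n : ∀ t → t ≤ suc (suc k) → P t < suc (suc (suc k)))
  (P-onto : ∀ u → u < suc (suc (suc k)) → Σ ℕ λ t → t ≤ suc (suc k) × P t ≡ u)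
  (lap-cycle : ∀ z w → lap (newEdges nothing 0 (suc (suc (suc k)))) z w
                       ≡ edgeLap (P (suc (suc k)) , P 0) z w + pathLap P (suc (suc k)) z w)
  (cycle<n : EdgesIn (_< suc (suc (suc k))) (newEdges nothing 0 (suc (suc (suc k)))))
  (cycle-loopless : NoLoop (newEdges nothing 0 (suc (suc (suc k)))))
  (exit-start : P d ≡ d₁) (exit-end : P (suc d) ≡ succMod (suc (suc (suc k))) d₁)
  (s₀ : State) (c₁ : ℕ → ℤ) (y₀ : ℕ)
  (c₁-on-path : ∀ t → t ≤ suc (suc k) → c₁ (P t) ≡ potential s₀ (suc (suc (suc k))) (suc d) t)
  (c₁0 : c₁ 0 ≡ 0ℤ) (c₁y₀ : c₁ y₀ ≡ 1ℤ) (y₀<n : y₀ < suc (suc (suc k)))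
  (ends : (P 0 ≡ 0 × P (suc (suc k)) ≡ y₀) ⊎ (P 0 ≡ y₀ × P (suc (suc k)) ≡ 0))
  (inv₀ : Invariant s₀ 0ℤ 1ℤ) (closing-flux : E s₀ ≡ cb s₀ - ca s₀)
  where

  n m : ℕ
  n = suc (suc (suc k))
  m = suc (suc k)

  a₁b₁ : ℕ × ℕ
  a₁b₁ = orient f₁ (P d) (P (suc d))
  a₁ b₁ : ℕ
  a₁ = proj₁ a₁b₁
  b₁ = proj₂ a₁b₁
  s₁ : State
  s₁ = nextState s₀ n (suc d) f₁

  exit≢ : P d ≢ P (suc d)
  exit≢ e = ℕₚ.1+n≢n (sym (injective d (suc d) (ℕₚ.<⇒≤ d<m) d<m e))

  a₁b₁<n : a₁ < n × b₁ < n
  a₁b₁<n = orient-both (_< n) f₁ (P<n d (ℕₚ.<⇒≤ d<m)) (P<n (suc d) d<m)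

  open TailShape (tail-shape rest n a₁ b₁ valid (proj₁ a₁b₁<n) (proj₂ a₁b₁<n) (orient-≢ f₁ exit≢))

  Nt : ℕ
  Nt = proj₁ (build n (just a₁b₁) rest)
  cycle tail es : List Edge
  cycle = newEdges nothing 0 n
  tail  = proj₂ (build n (just a₁b₁) rest)
  es    = cycle ++ tail

  graph≡ : build 0 nothing ((n , d₁ , f₁) ∷ rest) ≡ (Nt , es)
  graph≡ = trans (build-first n d₁ f₁ rest)
    (cong (λ ab → proj₁ (build n (just ab) rest) , cycle ++ proj₂ (build n (just ab) rest))
          (cong₂ (orient f₁) (sym exit-start) (sym exit-end)))

  c : ℕ → ℤ
  c w = if w <ᵇ n then c₁ w else chainPotential n s₁ rest w

  c-on-path : ∀ t → t ≤ m → c (P t) ≡ potential s₀ n (suc d) t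
  c-on-path t t≤m rewrite <⇒<ᵇ-true (P<n t t≤m) = c₁-on-path t t≤m

  c-beyond : ∀ w → n ≤ w → c w ≡ chainPotential n s₁ rest w
  c-beyond w n≤w rewrite ≤⇒<ᵇ-false n≤w = refl

  lastA lastB : ℕ
  lastA = proj₁ (lastEdge n a₁ b₁ rest)
  lastB = proj₂ (lastEdge n a₁ b₁ rest)

  lap-c : ∀ w → lap es c w ≡ E (finalState s₁ rest) * (δ lastB w - δ lastA w)
  lap-c w = begin
    lap es c w
      ≡⟨ trans (lap-++ cycle tail c w) (cong (_+ lap tail c w) (lap-cycle c w)) ⟩
    edgeLap (P m , P 0) c w + pathLap P m c w + lap tail c w
      ≡⟨ cong (λ x → x + pathLap P m c w + lap tail c w) closing ⟩
    E s₀ * (δ (P 0) w - δ (P m) w) + pathLap P m c w + lap tail c w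
      ≡⟨ ring (E s₀ * (δ (P 0) w - δ (P m) w)) (pathLap P m c w) (lap tail c w) ⟩
    lap tail c w + (pathLap P m c w + E s₀ * (δ (P 0) w - δ (P m) w))
      ≡⟨ cong (_+_ (lap tail c w)) (pathLap-kinked c (E s₀) (kink s₀ n) d injective d<m slope w) ⟩
    lap tail c w + kink s₀ n * (δ (P (suc d)) w - δ (P d) w)
      ≡⟨ cong (_+_ (lap tail c w)) (kink-flux s₀ n (suc d) f₁ (P d) (P (suc d)) w) ⟩
    lap tail c w + E s₁ * (δ b₁ w - δ a₁ w)
      ≡⟨ lap-tail rest n a₁ b₁ s₁ valid (proj₁ a₁b₁<n) (proj₂ a₁b₁<n) (orient-≢ f₁ exit≢) c
                  (proj₁ c-a₁b₁) (proj₂ c-a₁b₁) c-beyond w ⟩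
    E (finalState s₁ rest) * (δ lastB w - δ lastA w) ∎
    where
    open ≡-Reasoning
    ring : ∀ x p t → x + p + t ≡ t + (p + x)
    ring = solve-∀
    slope : ∀ t → t < m → c (P (suc t)) ≡ c (P t) + (E s₀ + δ d t * kink s₀ n)
    slope = potential-slope c s₀ n d c-on-path
    closing : edgeLap (P m , P 0) c w ≡ E s₀ * (δ (P 0) w - δ (P m) w)
    closing = trans (edgeLap-δ (P m) (P 0) c w)
      (cong (_* (δ (P 0) w - δ (P m) w))
            (trans (cong₂ _-_ (trans (c-on-path 0 z≤n) (potential-first s₀ n d))
                              (trans (c-on-path m ℕₚ.≤-refl) (potential-last s₀ n d d<m)))
                   (sym closing-flux)))
    c-a₁b₁ : c a₁ ≡ ca s₁ × c b₁ ≡ cb s₁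
    c-a₁b₁ = nextState-values c s₀ n d f₁ (c-on-path d (ℕₚ.<⇒≤ d<m)) (c-on-path (suc d) d<m)

  es<Nt : EdgesIn (_< Nt) es
  es<Nt = Allₚ.++⁺ (All.map (λ (p<n , q<n) → ℕₚ.<-≤-trans p<n N≤size , ℕₚ.<-≤-trans q<n N≤size) cycle<n)
                   (All.map (λ ((_ , p<) , (_ , q<)) → p< , q<) edges-near)

  es-loopless : NoLoop es
  es-loopless = Allₚ.++⁺ cycle-loopless loopless

  c0 : c 0 ≡ 0ℤ
  c0 = c₁0

  cy₀ : c y₀ ≡ 1ℤ
  cy₀ rewrite <⇒<ᵇ-true y₀<n = c₁y₀

  y₀<Nt : y₀ < Nt
  y₀<Nt = ℕₚ.<-≤-trans y₀<n N≤size

  harmonic : ∀ y → y < Nt → y ≢ lastA → y ≢ lastB → lap es c y ≡ 0ℤ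
  harmonic y _ y≢A y≢B rewrite lap-c y | δ-off (≢-sym y≢B) | δ-off (≢-sym y≢A) =
    ℤₚ.*-zeroʳ (E (finalState s₁ rest))

  open Firing es Nt
  open Collapse es<Nt c y₀
  open PathFiring es Nt es<Nt c y₀
  open TailFiring es Nt es<Nt c y₀

  away : ∀ t → t ≤ m → t ≢ d → t ≢ suc d → ∀ {v} → Near n a₁ b₁ v → P t ≢ v
  away t t≤m t≢d t≢d+1 (inj₁ refl) = proj₁ (orient-both (P t ≢_) f₁
    (λ e → t≢d (injective t d t≤m (ℕₚ.<⇒≤ d<m) e)) (λ e → t≢d+1 (injective t (suc d) t≤m d<m e)))
  away t t≤m t≢d t≢d+1 (inj₂ (inj₁ refl)) = proj₂ (orient-both (P t ≢_) f₁
    (λ e → t≢d (injective t d t≤m (ℕₚ.<⇒≤ d<m) e)) (λ e → t≢d+1 (injective t (suc d) t≤m d<m e)))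
  away t t≤m t≢d t≢d+1 (inj₂ (inj₂ n≤v)) Pt≡v = ℕₚ.<⇒≱ (P<n t t≤m) (subst (n ≤_) (sym Pt≡v) n≤v)

  P<Nt : ∀ t → t ≤ m → P t < Nt
  P<Nt t t≤m = ℕₚ.<-≤-trans (P<n t t≤m) N≤size

  collapsible-ends : Collapsible (P 0) × Collapsible (P m)
  collapsible-ends = from ends
    where
    sink : Collapsible 0
    sink = collapsible-sink (ℕₚ.<-≤-trans (s≤s z≤n) y₀<Nt) c0
    base : Collapsible y₀
    base = collapsible-base y₀<Nt cy₀
    from : (P 0 ≡ 0 × P m ≡ y₀) ⊎ (P 0 ≡ y₀ × P m ≡ 0) → Collapsible (P 0) × Collapsible (P m)
    from (inj₁ (P0≡0 , Pm≡y₀)) = subst Collapsible (sym P0≡0) sink , subst Collapsible (sym Pm≡y₀) base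
    from (inj₂ (P0≡y₀ , Pm≡0)) = subst Collapsible (sym P0≡y₀) base , subst Collapsible (sym Pm≡0) sink

  local : ∀ t → t ≤ m → t ≢ d → t ≢ suc d → ∀ u → u < Nt →
          Collapsible u ⊎ lap es (δ (P t)) u ≡ pathLap P m (δ (P t)) u
  local t t≤m t≢d t≢d+1 u u<Nt with u ℕₚ.≟ P 0 | u ℕₚ.≟ P m
  ... | yes refl | _        = inj₁ (proj₁ collapsible-ends)
  ... | no  _    | yes refl = inj₁ (proj₂ collapsible-ends)
  ... | no u≢P0  | no u≢Pm  = inj₂ (begin
    lap es (δ (P t)) u
      ≡⟨ trans (lap-++ cycle tail (δ (P t)) u) (cong (_+ lap tail (δ (P t)) u) (lap-cycle (δ (P t)) u)) ⟩
    edgeLap (P m , P 0) (δ (P t)) u + pathLap P m (δ (P t)) u + lap tail (δ (P t)) u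
      ≡⟨ cong₂ (λ x y → x + pathLap P m (δ (P t)) u + y) closing-away tail-vanishes ⟩
    0ℤ + pathLap P m (δ (P t)) u + 0ℤ
      ≡⟨ trans (ℤₚ.+-identityʳ _) (ℤₚ.+-identityˡ _) ⟩
    pathLap P m (δ (P t)) u ∎)
    where
    open ≡-Reasoning
    closing-away : edgeLap (P m , P 0) (δ (P t)) u ≡ 0ℤ
    closing-away rewrite δ-off (≢-sym u≢Pm) | δ-off (≢-sym u≢P0) = refl
    tail-vanishes : lap tail (δ (P t)) u ≡ 0ℤ
    tail-vanishes = lap-vanishing tail (δ (P t)) u
      (All.map (λ ((v-near , _) , (w-near , _)) → δ-off (away t t≤m t≢d t≢d+1 v-near) , δ-off (away t t≤m t≢d t≢d+1 w-near))
               edges-near)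

  all-collapsible : ∀ u → u < Nt → Collapsible u
  all-collapsible = collapsible-tail rest n a₁ b₁ valid (proj₁ a₁b₁<n) (proj₂ a₁b₁<n) (orient-≢ f₁ exit≢) refl
    cycle cycle<n refl harmonic on-cycle
    where
    collapsible-P : ∀ t → t ≤ m → Collapsible (P t)
    collapsible-P = collapsible-path P m d injective d<m P<Nt
      (λ t t≤m t≢d t≢d+1 → harmonic (P t) (P<Nt t t≤m) (away t t≤m t≢d t≢d+1 (proj₁ last-near))
                                                         (away t t≤m t≢d t≢d+1 (proj₂ last-near)))
      local (proj₁ collapsible-ends) (proj₂ collapsible-ends)
    on-cycle : ∀ u → u < n → Collapsible u
    on-cycle u u<n with P-onto u u<n
    ... | t , t≤m , Pt≡u = subst Collapsible Pt≡u (collapsible-P t t≤m)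

  x : ℤ
  x = xSeq (n ∷ map proj₁ rest)

  final-flux : Σ ℤ λ σ → (σ ≡ 1ℤ ⊎ σ ≡ -1ℤ) × E (finalState s₁ rest) ≡ σ * x
  final-flux with finalState-flux rest s₁ 1ℤ (+ n * 1ℤ - 0ℤ) valid (invariant-next s₀ 0ℤ 1ℤ k d f₁ d<m inv₀)
  ... | σ , unit , flux = σ , unit , trans flux (cong (σ *_) (sym (xSeq-∷ n (map proj₁ rest))))

  jacobian : JacCyclicOfOrder (build 0 nothing ((n , d₁ , f₁) ∷ rest)) x
  jacobian = subst (λ G → JacCyclicOfOrder G x) (sym graph≡)
    (jacobian-cyclic Nt es es<Nt es-loopless c y₀ c0 y₀<Nt cy₀ all-collapsible x x∣lap lastB lastB<Nt lap-lastB)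
    where
    σ : ℤ
    σ = proj₁ final-flux
    flux : E (finalState s₁ rest) ≡ σ * x
    flux = proj₂ (proj₂ final-flux)
    x∣lap : ∀ u → u < Nt → x ℤ∣.∣ lap es c u
    x∣lap u _ rewrite lap-c u | flux = ℤ∣.∣m⇒∣m*n _ (ℤ∣.∣n⇒∣m*n σ ℤ∣.∣-refl)
    lastB<Nt : lastB < Nt
    lastB<Nt = proj₂ last<size
    lap-lastB : lap es c lastB ≡ x ⊎ lap es c lastB ≡ - x
    lap-lastB rewrite lap-c lastB | δ-diag lastB | δ-off last≢ | flux = ±x σ (proj₁ (proj₂ final-flux))
      where
      ±x : ∀ σ → σ ≡ 1ℤ ⊎ σ ≡ -1ℤ → σ * x * (1ℤ - 0ℤ) ≡ x ⊎ σ * x * (1ℤ - 0ℤ) ≡ - x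
      ±x σ (inj₁ refl) = inj₁ (ring x)
        where
        ring : ∀ x → 1ℤ * x * (1ℤ - 0ℤ) ≡ x
        ring = solve-∀
      ±x σ (inj₂ refl) = inj₂ (ring x)
        where
        ring : ∀ x → -1ℤ * x * (1ℤ - 0ℤ) ≡ - x
        ring = solve-∀

module _ (k : ℕ) (f₁ : Bool) (rest : List Cycle) (valid : ValidTail rest) where

  private
    n m : ℕ
    n = suc (suc (suc k))
    m = suc (suc k)

    succMod-≤m : ∀ t → t ≤ m → succMod n t < n
    succMod-≤m t t≤m with t ℕₚ.≟ m
    ... | yes refl rewrite succMod-last m = s≤s z≤n
    ... | no  t≢m  rewrite succMod-< n t (s≤s (ℕₚ.≤∧≢⇒< t≤m t≢m)) = s≤s (ℕₚ.≤∧≢⇒< t≤m t≢m)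

    cycle<n : EdgesIn (_< n) (newEdges nothing 0 n)
    cycle<n = All-map-applyUpTo (λ j → j , succMod n j) (λ x → x) n
      (λ t t<n → t<n , succMod-≤m t (ℕₚ.≤-pred t<n))

    cycle-loopless : NoLoop (newEdges nothing 0 n)
    cycle-loopless = All-map-applyUpTo (λ j → j , succMod n j) (λ x → x) n
      (λ t t<n → loopless t (ℕₚ.≤-pred t<n))
      where
      loopless : ∀ t → t ≤ m → t ≢ succMod n t
      loopless t t≤m with t ℕₚ.≟ m
      ... | yes refl rewrite succMod-last m = λ ()
      ... | no  t≢m  rewrite succMod-< n t (s≤s (ℕₚ.≤∧≢⇒< t≤m t≢m)) = ≢-sym ℕₚ.1+n≢n

    lap-cycle : ∀ z w → lap (newEdges nothing 0 n) z w ≡ ∑< n (λ t → edgeLap (t , succMod n t) z w)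
    lap-cycle = lap-map-applyUpTo (λ j → j , succMod n j) (λ x → x) n

  -- Exit along 0 — 1: traverse the cycle as 0, 1, …, n - 1, closing along n - 1 — 0.
  jacobian-exit-zero : JacCyclicOfOrder (build 0 nothing ((n , 0 , f₁) ∷ rest)) (xSeq (n ∷ map proj₁ rest))
  jacobian-exit-zero = FirstCycle.jacobian k 0 (s≤s z≤n) 0 f₁ rest valid
    (λ t → t) (λ _ _ _ _ e → e) (λ t t≤m → s≤s t≤m) (λ u u<n → u , ℕₚ.≤-pred u<n , refl) lap-as-path
    cycle<n cycle-loopless refl refl s₀ (potential s₀ n 1) m (λ _ _ → refl) (potential-first s₀ n 0)
    (potential-last s₀ n 0 (s≤s z≤n)) ℕₚ.≤-refl (inj₁ (refl , refl)) (invariant -1ℤ (inj₂ refl) refl refl) refl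
    where
    s₀ : State
    s₀ = state 1ℤ 0ℤ -1ℤ
    lap-as-path : ∀ z w → lap (newEdges nothing 0 n) z w ≡ edgeLap (m , 0) z w + pathLap (λ t → t) m z w
    lap-as-path z w = trans (lap-cycle z w)
      (trans (cong₂ _+_ (∑<-cong m (λ t t<m → cong (λ x → edgeLap (t , x) z w) (succMod-< n t (s≤s t<m))))
                        (cong (λ x → edgeLap (m , x) z w) (succMod-last m)))
             (ℤₚ.+-comm (pathLap (λ t → t) m z w) (edgeLap (m , 0) z w)))

  -- Exit along d + 1 — d + 2 (mod n): traverse the cycle as 1, 2, …, n - 1, 0,
  -- closing along 0 — 1, which is then never the exit edge.
  jacobian-exit-suc : ∀ d → suc d ≤ m →
    JacCyclicOfOrder (build 0 nothing ((n , suc d , f₁) ∷ rest)) (xSeq (n ∷ map proj₁ rest))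
  jacobian-exit-suc d d<m = FirstCycle.jacobian k d d<m (suc d) f₁ rest valid
    (succMod n) injective succMod-≤m onto lap-as-path cycle<n cycle-loopless (succMod-< n d (s≤s d<m)) refl
    s₀ c₁ 1 on-path refl (potential-first s₀ n d) (s≤s (s≤s z≤n)) (inj₂ (refl , succMod-last m))
    (invariant 1ℤ (inj₁ refl) refl refl) refl
    where
    s₀ : State
    s₀ = state 0ℤ 1ℤ 1ℤ
    c₁ : ℕ → ℤ
    c₁ zero    = 0ℤ
    c₁ (suc w) = potential s₀ n (suc d) w
    injective : InjectiveUpTo (succMod n) m
    injective s t s≤m t≤m e with s ℕₚ.≟ m | t ℕₚ.≟ m
    ... | yes refl | yes refl = refl
    ... | yes refl | no t≢m
      rewrite succMod-last m | succMod-< n t (s≤s (ℕₚ.≤∧≢⇒< t≤m t≢m)) = ⊥-elim (ℕₚ.0≢1+n e)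
    ... | no s≢m   | yes refl
      rewrite succMod-last m | succMod-< n s (s≤s (ℕₚ.≤∧≢⇒< s≤m s≢m)) = ⊥-elim (ℕₚ.0≢1+n (sym e))
    ... | no s≢m   | no t≢m
      rewrite succMod-< n s (s≤s (ℕₚ.≤∧≢⇒< s≤m s≢m)) | succMod-< n t (s≤s (ℕₚ.≤∧≢⇒< t≤m t≢m)) =
      ℕₚ.suc-injective e
    onto : ∀ u → u < n → Σ ℕ λ t → t ≤ m × succMod n t ≡ u
    onto zero    _     = m , ℕₚ.≤-refl , succMod-last m
    onto (suc u) u+1<n = u , ℕₚ.≤-pred (ℕₚ.<⇒≤ u+1<n) , succMod-< n u u+1<n
    lap-as-path : ∀ z w → lap (newEdges nothing 0 n) z w
                          ≡ edgeLap (succMod n m , succMod n 0) z w + pathLap (succMod n) m z w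
    lap-as-path z w = trans (lap-cycle z w) (trans (∑<-suc m (λ t → edgeLap (t , succMod n t) z w))
      (cong₂ _+_ (cong (λ x → edgeLap (x , 1) z w) (sym (succMod-last m)))
                 (∑<-cong m (λ t t<m → cong (λ x → edgeLap (x , succMod n (suc t)) z w)
                                             (sym (succMod-< n t (s≤s t<m)))))))
    on-path : ∀ t → t ≤ m → c₁ (succMod n t) ≡ potential s₀ n (suc d) t
    on-path t t≤m with t ℕₚ.≟ m
    ... | yes refl rewrite succMod-last m = sym (potential-last s₀ n d d<m)
    ... | no  t≢m  rewrite succMod-< n t (s≤s (ℕₚ.≤∧≢⇒< t≤m t≢m)) = refl

jacobian-chain : ∀ n₁ d₁ f₁ rest → 3 ≤ n₁ → d₁ < n₁ → ValidTail rest →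
  JacCyclicOfOrder (build 0 nothing ((n₁ , d₁ , f₁) ∷ rest)) (xSeq (n₁ ∷ map proj₁ rest))
jacobian-chain .(suc (suc (suc k))) zero    f₁ rest (s≤s (s≤s (s≤s {n = k} _))) _   valid =
  jacobian-exit-zero k f₁ rest valid
jacobian-chain .(suc (suc (suc k))) (suc d) f₁ rest (s≤s (s≤s (s≤s {n = k} _))) d<n valid =
  jacobian-exit-suc k f₁ rest valid d (ℕₚ.≤-pred d<n)

validTail : ∀ k (ns ds : Vec ℕ k) (fs : Vec Bool k) →
  (∀ i → 3 ≤ lookup ns i) → (∀ i → lookup ds i < lookup ns i) → (∀ i → 1 ≤ lookup ds i) →
  ValidTail (toList (zip ns (zip ds fs)))
validTail zero    []       []       []       _   _   _   = []
validTail (suc k) (n ∷ ns) (d ∷ ds) (f ∷ fs) n≥3 d<n d≥1 =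
  (n≥3 Fin.zero , d≥1 Fin.zero , d<n Fin.zero)
  ∷ validTail k ns ds fs (λ i → n≥3 (Fin.suc i)) (λ i → d<n (Fin.suc i)) (λ i → d≥1 (Fin.suc i))

cycle-lengths : ∀ {k} (ns ds : Vec ℕ k) (fs : Vec Bool k) → map proj₁ (toList (zip ns (zip ds fs))) ≡ toList ns
cycle-lengths ns ds fs = trans (sym (Vecₚ.toList-map proj₁ (zip ns (zip ds fs)))) (cong toList (Vecₚ.map-proj₁-zip ns (zip ds fs)))

proposition4p5 : (k : ℕ) → 1 ≤ k →
    (ns ds : Vec ℕ k) (fs : Vec Bool k) →
    (∀ (i : Fin k) → 3 ≤ lookup ns i) →
    (∀ (i : Fin k) → lookup ds i < lookup ns i) →
    (∀ (i : Fin k) → toℕ i ≢ 0 → 1 ≤ lookup ds i) →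
    JacCyclicOfOrder (chainGraph ns ds fs) (xSeq (toList ns))
proposition4p5 (suc k) _ (n₁ ∷ ns) (d₁ ∷ ds) (f₁ ∷ fs) n≥3 d<n d≥1 =
  subst (λ l → JacCyclicOfOrder (chainGraph (n₁ ∷ ns) (d₁ ∷ ds) (f₁ ∷ fs)) (xSeq (n₁ ∷ l)))
        (cycle-lengths ns ds fs)
        (jacobian-chain n₁ d₁ f₁ _ (n≥3 Fin.zero) (d<n Fin.zero)
          (validTail k ns ds fs (λ i → n≥3 (Fin.suc i)) (λ i → d<n (Fin.suc i)) (λ i → d≥1 (Fin.suc i) (λ ()))))
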